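{- Let $A$ be a commutative (not necessarily unital) $\mathbb K$-algebra and consider $QS(A)$ with the quasi-shuffle product $\uplus$ and the deconcatenation coproduct $\Delta$. For linear endomorphisms $f,g$ of $QS(A)$ define the convolution $f\star g:=\uplus\circ(f\otimes g)\circ\Delta$. For each packed word $u$ let $\rho(\mathbf M_u)$ be the endomorphism $x\mapsto x\mathbf M_u$. Then for all packed words $u,v$, $\rho(\mathbf M_u\mathbf M_v)=\rho(\mathbf M_u)\star\rho(\mathbf M_v)$, where $\mathbf M_u\mathbf M_v$ is the (outer) product of $\mathbf{WQSym}$ and $\rho$ is extended linearly.
   Context: $\mathbb K$ is a field of characteristic zero. A packed word $u=u_1\cdots u_m$ is a word over the positive integers whose letter set is $\{1,\dots,k\}$, $k=\max(u)$; it is identified with the surjection $u:[m]\to[k]$. For a word $w$, $\mathrm{pack}(w)$ replaces the $i$-th smallest letter of $w$ by $i$. $\mathbf{WQSym}$ has basis $\mathbf M_u=\sum_{\mathrm{pack}(w)=u}w$ with product $\mathbf M_u\mathbf M_v=\sum\mathbf M_w$ over packed words $w=u'v'$ with $\mathrm{pack}(u')=u$, $\mathrm{pack}(v')=v$. $QS(A)=\bigoplus_{n\ge0}A^{\otimes n}$ ($A^{\otimes0}=\mathbb K$, unit $1$), with quasi-shuffle product defined recursively by $1\uplus x=x\uplus 1=x$ and $(a_1\otimes\cdots\otimes a_n)\uplus(b_1\otimes\cdots\otimes b_m)=a_1\otimes((a_2\otimes\cdots\otimes a_n)\uplus(b_1\otimes\cdots\otimes b_m))+b_1\otimes((a_1\otimes\cdots\otimes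 a_n)\uplus(b_2\otimes\cdots\otimes b_m))+a_1b_1\otimes((a_2\otimes\cdots\otimes a_n)\uplus(b_2\otimes\cdots\otimes b_m))$, and deconcatenation coproduct $\Delta(a_1\otimes\cdots\otimes a_n)=\sum_{i=0}^n(a_1\otimes\cdots\otimes a_i)\otimes(a_{i+1}\otimes\cdots\otimes a_n)$. The right action is $(a_1\otimes\cdots\otimes a_n)\mathbf M_u=\delta_m^n\,b_1\otimes\cdots\otimes b_k$ with $b_i=\prod_{u(j)=i}a_j$, for $u:[m]\to[k]$. -}

module Defs where

open import Level using (Level; _⊔_; suc)
open import Algebra.Bundles using (CommutativeRing)
open import Algebra.Module.Bundles using (Module)
open import Algebra.Core using (Op₂)
open import Relation.Nullary using (¬_; Dec; yes; no)
open import Relation.Nullary.Decidable using (_×-dec_)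
open import Data.Product using (Σ; _×_; _,_; proj₁; proj₂)
open import Data.Nat as ℕ using (ℕ; zero; _≤_; _≤?_; _<?_; _≟_)
import Data.Nat
open import Data.List using (List; []; _∷_; _++_; map; concatMap; filter; length; zip; take; drop; upTo; foldr; deduplicate)
open import Data.List.Properties using (≡-dec)
open import Data.List.Relation.Unary.All using (All; all?)
open import Data.List.Membership.Propositional using (_∈_)
open import Data.List.Membership.DecPropositional (_≟_) using (_∈?_)
open import Data.List.Relation.Binary.Pointwise using (Pointwise)
open import Relation.Binary.PropositionalEquality using (_≡_)

record Field c ℓ : Set (suc (c ⊔ ℓ)) where
  field
    commutativeRing : CommutativeRing c ℓ
  open CommutativeRing commutativeRing public
  field
    1≉0     : ¬ (1# ≈ 0#)
    inverse : ∀ x → ¬ (x ≈ 0#) → Σ Carrier (λ y → x * y ≈ 1#)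

natK : ∀ {c ℓ} (K : Field c ℓ) → ℕ → Field.Carrier K
natK K zero = Field.0# K
natK K (ℕ.suc n) = Field._+_ K (Field.1# K) (natK K n)

CharZero : ∀ {c ℓ} → Field c ℓ → Set ℓ
CharZero K = ∀ n → ¬ (Field._≈_ K (natK K (ℕ.suc n)) (Field.0# K))

record CommAlgebra {c ℓ} (K : Field c ℓ) m ℓm : Set (c ⊔ ℓ ⊔ suc (m ⊔ ℓm)) where
  field
    module' : Module (Field.commutativeRing K) m ℓm
  open Module module' public
  infixl 7 _·_
  field
    _·_        : Op₂ Carrierᴹ
    ·-cong     : ∀ {x x' y y'} → x ≈ᴹ x' → y ≈ᴹ y' → (x · y) ≈ᴹ (x' · y')
    ·-assoc    : ∀ x y z → ((x · y) · z) ≈ᴹ (x · (y · z))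
    ·-comm     : ∀ x y → (x · y) ≈ᴹ (y · x)
    ·-distribʳ : ∀ x y z → ((x +ᴹ y) · z) ≈ᴹ ((x · z) +ᴹ (y · z))
    ·-*ₗ       : ∀ k x y → ((k *ₗ x) · y) ≈ᴹ (k *ₗ (x · y))

maxL : List ℕ → ℕ
maxL = foldr ℕ._⊔_ 0

range1 : ℕ → List ℕ
range1 k = map ℕ.suc (upTo k)

IsPacked : List ℕ → Set
IsPacked u = All (1 ≤_) u × All (_∈ u) (range1 (maxL u))

isPacked? : (u : List ℕ) → Dec (IsPacked u)
isPacked? u = all? (1 ≤?_) u ×-dec all? (_∈? u) (range1 (maxL u))

pack : List ℕ → List ℕ
pack w = map (λ x → ℕ.suc (length (deduplicate _≟_ (filter (_<? x) w)))) w

_≟L_ : (u v : List ℕ) → Dec (u ≡ v)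
_≟L_ = ≡-dec _≟_

wordsOf : ℕ → ℕ → List (List ℕ)
wordsOf zero N = [] ∷ []
wordsOf (ℕ.suc n) N = concatMap (λ a → map (a ∷_) (wordsOf n N)) (range1 N)

-- M_u M_v = Σ M_w over packed w = u'v' with pack u' = u, pack v' = v;
-- represented as the list of these (distinct) w, each with coefficient 1.
-- (Such w has length |u|+|v|, hence letters in {1..|u|+|v|}.)
MProd : List ℕ → List ℕ → List (List ℕ)
MProd u v = filter (λ w → isPacked? w ×-dec ((pack (take (length u) w) ≟L u) ×-dec (pack (drop (length u) w) ≟L v)))
                   (wordsOf (length u Data.Nat.+ length v) (length u Data.Nat.+ length v))

-- QS(A) = ⊕_n A^{⊗n}, as formal K-linear combinations of words over A
-- modulo the K-module laws and multilinearity in every tensor slot.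

module QS {c ℓ m ℓm} (K : Field c ℓ) (A : CommAlgebra K m ℓm) where
  open Field K using () renaming (Carrier to 𝕂; _+_ to _+K_; _*_ to _*K_; 0# to 0K; 1# to 1K; _≈_ to _≈K_)
  open CommAlgebra A using (Carrierᴹ; _≈ᴹ_; _+ᴹ_; _*ₗ_; 0ᴹ; _·_)

  Word : Set m
  Word = List Carrierᴹ

  FS : Set (c ⊔ m)
  FS = List (𝕂 × Word)

  infix 4 _∼_
  data _∼_ : FS → FS → Set (c ⊔ ℓ ⊔ m ⊔ ℓm) where
    ∼-refl  : ∀ {x} → x ∼ x
    ∼-sym   : ∀ {x y} → x ∼ y → y ∼ x
    ∼-trans : ∀ {x y z} → x ∼ y → y ∼ z → x ∼ z
    ∼-++    : ∀ {x x' y y'} → x ∼ x' → y ∼ y' → (x ++ y) ∼ (x' ++ y')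
    ∼-comm  : ∀ x y → (x ++ y) ∼ (y ++ x)
    coef-+  : ∀ c d w → ((c , w) ∷ (d , w) ∷ []) ∼ ((c +K d , w) ∷ [])
    coef-0  : ∀ w → ((0K , w) ∷ []) ∼ []
    coef-≈  : ∀ {c d} w → c ≈K d → ((c , w) ∷ []) ∼ ((d , w) ∷ [])
    word-≈  : ∀ c {w w'} → Pointwise _≈ᴹ_ w w' → ((c , w) ∷ []) ∼ ((c , w') ∷ [])
    lin-+   : ∀ c p a b s → ((c , p ++ (a +ᴹ b) ∷ s) ∷ []) ∼ ((c , p ++ a ∷ s) ∷ (c , p ++ b ∷ s) ∷ [])
    lin-*   : ∀ c p d a s → ((c , p ++ (d *ₗ a) ∷ s) ∷ []) ∼ ((c *K d , p ++ a ∷ s) ∷ [])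

  scale : 𝕂 → FS → FS
  scale k = map (λ { (d , w) → (k *K d , w) })

  prepend : Carrierᴹ → FS → FS
  prepend a = map (λ { (d , w) → (d , a ∷ w) })

  lin : (Word → FS) → FS → FS
  lin f [] = []
  lin f ((k , w) ∷ x) = scale k (f w) ++ lin f x

  bil : (Word → Word → FS) → FS → FS → FS
  bil f x y = lin (λ w → lin (λ w' → f w w') y) x

  qsh : Word → Word → FS
  qsh [] y = (1K , y) ∷ []
  qsh (a ∷ x) [] = (1K , a ∷ x) ∷ []
  qsh (a ∷ x) (b ∷ y) = prepend a (qsh x (b ∷ y)) ++ prepend b (qsh (a ∷ x) y) ++ prepend (a · b) (qsh x y)

  _⊎_ : FS → FS → FS
  _⊎_ = bil qsh

  splits : Word → List (Word × Word)
  splits [] = ([] , []) ∷ []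
  splits (a ∷ w) = ([] , a ∷ w) ∷ map (λ { (p , s) → (a ∷ p , s) }) (splits w)

  word : Word → FS
  word w = (1K , w) ∷ []

  _⋆_ : (FS → FS) → (FS → FS) → (FS → FS)
  (f ⋆ g) = lin (λ w → concatMap (λ { (p , s) → f (word p) ⊎ g (word s) }) (splits w))

  -- product in A of a (nonempty, for packed u) list; [] ↦ 0 is never used
  prodA : Word → Carrierᴹ
  prodA [] = 0ᴹ
  prodA (a ∷ []) = a
  prodA (a ∷ b ∷ l) = a · prodA (b ∷ l)

  actM : List ℕ → Word → FS
  actM u w with length w ≟ length u
  ... | no _ = []
  ... | yes _ = (1K , map (λ i → prodA (map proj₂ (filter (λ p → proj₁ p ≟ i) (zip u w)))) (range1 (maxL u))) ∷ []

  ρ : List ℕ → FS → FS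
  ρ u = lin (actM u)

  ρΣ : List (List ℕ) → FS → FS
  ρΣ L = lin (λ w → concatMap (λ t → actM t w) L)

-- Both sides are linear, so it suffices to compare them on one tensor x = a₁ ⊗ ⋯ ⊗ a_N. On the right
-- only the deconcatenation x = p ⊗ s with |p| = |u| and |s| = |v| survives, leaving the quasi-shuffle
-- of b = p M_u and c = s M_v. Its terms are indexed by pairs (s₁ , s₂) of increasing sequences of
-- lengths |b| and |c| whose union is {1, ..., r}: the term puts bᵢ at position s₁(i) and cⱼ at s₂(j),
-- multiplying letters that land on the same position. The relabelled words (s₁ ∘ u)(s₂ ∘ v) are exactly
-- the packed words of M_u M_v, each occurring once, and by associativity of A the action of
-- M_{(s₁ ∘ u)(s₂ ∘ v)} on x is the term indexed by (s₁ , s₂).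

module Submission where

open import Defs
open import Level using () renaming (_⊔_ to _⊔ˡ_)
open import Data.Nat as ℕ using (ℕ; zero; suc; pred; _+_; _≤_; _<_; _⊔_; z≤n; s≤s; _≟_; _<?_)
open import Data.Nat.Properties
open import Data.Product using (Σ; _×_; _,_; proj₁; proj₂)
import Data.Sum as Sum
open Sum using (inj₁; inj₂)
open import Data.Empty using (⊥-elim)
open import Data.Unit using (⊤; tt)
import Data.List as List
open import Data.List using (List; []; _∷_; _++_; map; filter; length; zip; take; drop; upTo; deduplicate; concatMap)
open import Data.List.Properties
  using ( map-∘; map-id; map-cong-local; map-++; map-injective; map-applyUpTo; length-map; length-++; length-take; length-drop
        ; length-applyUpTo; take++drop≡id; ++-cancelˡ; ++-identityʳ; ∷-injectiveˡ; ∷-injectiveʳ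
        ; filter-accept; filter-reject; filter-++; filter-none)
open import Data.List.Membership.Propositional using (_∈_; _∉_)
open import Data.List.Membership.Propositional.Properties
open import Data.List.Membership.Propositional.Properties.WithK using (unique∧set⇒bag)
open import Data.List.Membership.DecPropositional (_≟_) using (_∈?_)
open import Data.List.Relation.Unary.Any using (here; there)
open import Data.List.Relation.Unary.All as All using (All; []; _∷_)
import Data.List.Relation.Unary.All.Properties as All
open import Data.List.Relation.Unary.AllPairs using ([]; _∷_)
open import Data.List.Relation.Unary.Unique.Propositional using (Unique)
import Data.List.Relation.Unary.Unique.Propositional.Properties as Unique
open import Data.List.Relation.Unary.Unique.DecPropositional.Properties _≟_ using (deduplicate-!)
open import Data.List.Relation.Binary.Subset.Propositional using (_⊆_)
import Data.List.Relation.Binary.Subset.Propositional.Properties as ⊆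
open import Data.List.Relation.Binary.Disjoint.Propositional using (Disjoint)
open import Data.List.Relation.Binary.Pointwise as Pointwise using (Pointwise)
import Data.List.Relation.Binary.Pointwise.Properties as Pointwise
open import Data.List.Relation.Binary.Permutation.Propositional using (_↭_)
import Data.List.Relation.Binary.Permutation.Propositional as ↭
import Data.List.Relation.Binary.Permutation.Propositional.Properties as ↭
open import Data.List.Relation.Binary.BagAndSetEquality using (∼bag⇒↭)
open import Relation.Nullary using (Dec; yes; no)
open import Relation.Nullary.Decidable using (_×-dec_)
open import Relation.Unary using (Pred; Decidable)
open import Relation.Binary.Definitions using (tri<; tri≈; tri>)
open import Relation.Binary.Bundles using (Setoid)
open import Relation.Binary.PropositionalEquality
import Relation.Binary.Reasoning.Setoid as ≈-Reasoning
open import Function using (_∘_; id)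
open import Function.Bundles using (mk⇔)

range1-suc : ∀ k → range1 (suc k) ≡ 1 ∷ map suc (range1 k)
range1-suc k = cong (λ z → 1 ∷ map suc z) (sym (map-applyUpTo id suc k))

map-range1-suc : ∀ {a} {A : Set a} (f : ℕ → A) k → map f (range1 (suc k)) ≡ f 1 ∷ map (f ∘ suc) (range1 k)
map-range1-suc f k = trans (cong (map f) (range1-suc k)) (cong (f 1 ∷_) (sym (map-∘ (range1 k))))

length-range1 : ∀ k → length (range1 k) ≡ k
length-range1 k = trans (length-map suc (upTo k)) (length-applyUpTo id k)

∈-range1⁺ : ∀ {j r} → 1 ≤ j → j ≤ r → j ∈ range1 r
∈-range1⁺ {suc j} (s≤s _) j≤r = ∈-map⁺ suc (∈-upTo⁺ j≤r)

∈-range1⁻ : ∀ {j r} → j ∈ range1 r → 1 ≤ j × j ≤ r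
∈-range1⁻ p with ∈-map⁻ suc p
... | i , i∈ , refl = s≤s z≤n , ∈-upTo⁻ i∈

unique-range1 : ∀ k → Unique (range1 k)
unique-range1 k = Unique.map⁺ suc-injective (Unique.upTo⁺ k)

∈⇒≤maxL : ∀ {j t} → j ∈ t → j ≤ maxL t
∈⇒≤maxL {t = x ∷ t} (here refl) = m≤m⊔n x (maxL t)
∈⇒≤maxL {t = x ∷ t} (there p) = ≤-trans (∈⇒≤maxL p) (m≤n⊔m x (maxL t))

maxL-lub : ∀ {t b} → (∀ {j} → j ∈ t → j ≤ b) → maxL t ≤ b
maxL-lub {[]} _ = z≤n
maxL-lub {x ∷ t} bound = ⊔-lub (bound (here refl)) (maxL-lub (bound ∘ there))

maxL-mono : ∀ {t t'} → t ⊆ t' → maxL t ≤ maxL t'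
maxL-mono t⊆t' = maxL-lub (∈⇒≤maxL ∘ t⊆t')

maxL-cong : ∀ {t t'} → t ⊆ t' → t' ⊆ t → maxL t ≡ maxL t'
maxL-cong t⊆t' t'⊆t = ≤-antisym (maxL-mono t⊆t') (maxL-mono t'⊆t)

maxL-range1 : ∀ k → maxL (range1 k) ≡ k
maxL-range1 zero = refl
maxL-range1 (suc k) = ≤-antisym (maxL-lub (proj₂ ∘ ∈-range1⁻)) (∈⇒≤maxL (∈-range1⁺ (s≤s z≤n) ≤-refl))

maxL-1∷map-suc : ∀ t → maxL (1 ∷ map suc t) ≡ suc (maxL t)
maxL-1∷map-suc [] = refl
maxL-1∷map-suc (x ∷ t) = begin
    1 ⊔ (suc x ⊔ maxL (map suc t))  ≡⟨ sym (⊔-assoc 1 (suc x) (maxL (map suc t))) ⟩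
    (1 ⊔ suc x) ⊔ maxL (map suc t)  ≡⟨ cong (_⊔ maxL (map suc t)) (⊔-comm 1 (suc x)) ⟩
    (suc x ⊔ 1) ⊔ maxL (map suc t)  ≡⟨ ⊔-assoc (suc x) 1 (maxL (map suc t)) ⟩
    suc x ⊔ (1 ⊔ maxL (map suc t))  ≡⟨ cong (suc x ⊔_) (maxL-1∷map-suc t) ⟩
    suc (x ⊔ maxL t)                ∎
  where open ≡-Reasoning

∈-remove : ∀ {x : ℕ} {ys} → x ∈ ys → Σ (List ℕ) λ zs → length ys ≡ suc (length zs) × (∀ {z} → z ∈ ys → z ≢ x → z ∈ zs)
∈-remove {ys = y ∷ ys} (here refl) = ys , refl , λ { (here refl) z≢x → ⊥-elim (z≢x refl) ; (there p) _ → p }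
∈-remove {ys = y ∷ ys} (there p) with ∈-remove p
... | zs , len , keep = y ∷ zs , cong suc len , λ { (here refl) _ → here refl ; (there q) z≢x → there (keep q z≢x) }

Unique-⊆⇒length≤ : ∀ {xs ys : List ℕ} → Unique xs → xs ⊆ ys → length xs ≤ length ys
Unique-⊆⇒length≤ {[]} _ _ = z≤n
Unique-⊆⇒length≤ {x ∷ xs} (x∉xs ∷ unique) xs⊆ys with ∈-remove (xs⊆ys (here refl))
... | zs , len , keep = ≤-trans (s≤s (Unique-⊆⇒length≤ unique xs⊆zs)) (≤-reflexive (sym len))
  where
  xs⊆zs : xs ⊆ zs
  xs⊆zs z∈ = keep (xs⊆ys (there z∈)) (λ { refl → All.lookup x∉xs z∈ refl })

Unique-⊆⊇⇒length≡ : ∀ {xs ys : List ℕ} → Unique xs → Unique ys → xs ⊆ ys → ys ⊆ xs → length xs ≡ length ys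
Unique-⊆⊇⇒length≡ uxs uys xs⊆ys ys⊆xs = ≤-antisym (Unique-⊆⇒length≤ uxs xs⊆ys) (Unique-⊆⇒length≤ uys ys⊆xs)

range1⊆⇒≤length : ∀ {k t} → range1 k ⊆ t → k ≤ length t
range1⊆⇒≤length {k} range1⊆t = ≤-trans (≤-reflexive (sym (length-range1 k))) (Unique-⊆⇒length≤ (unique-range1 k) range1⊆t)

Unique-map-injectiveOn : ∀ {A B : Set} (g : A → B) {R} → Unique R → (∀ {a b} → a ∈ R → b ∈ R → g a ≡ g b → a ≡ b) → Unique (map g R)
Unique-map-injectiveOn g {[]} _ _ = []
Unique-map-injectiveOn g {a ∷ R} (a∉R ∷ uniqueR) injective =
  All.tabulate (λ z∈ ga≡z → let (b , b∈R , z≡gb) = ∈-map⁻ g z∈ in All.lookup a∉R b∈R (injective (here refl) (there b∈R) (trans ga≡z z≡gb)))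
  ∷ Unique-map-injectiveOn g uniqueR (λ p q → injective (there p) (there q))

take-length-++ : ∀ {a} {A : Set a} (xs ys : List A) → take (length xs) (xs ++ ys) ≡ xs
take-length-++ [] ys = refl
take-length-++ (x ∷ xs) ys = cong (x ∷_) (take-length-++ xs ys)

drop-length-++ : ∀ {a} {A : Set a} (xs ys : List A) → drop (length xs) (xs ++ ys) ≡ ys
drop-length-++ [] ys = refl
drop-length-++ (x ∷ xs) ys = drop-length-++ xs ys

zip-∈₁ : ∀ {a b} {A : Set a} {B : Set b} {u : List A} {t : List B} {i x} → (i , x) ∈ zip u t → i ∈ u
zip-∈₁ {u = _ ∷ _} {t = _ ∷ _} (here refl) = here refl
zip-∈₁ {u = _ ∷ _} {t = _ ∷ _} (there p) = there (zip-∈₁ p)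

zip-∈₂ : ∀ {a b} {A : Set a} {B : Set b} {u : List A} {t : List B} {i x} → (i , x) ∈ zip u t → x ∈ t
zip-∈₂ {u = _ ∷ _} {t = _ ∷ _} (here refl) = here refl
zip-∈₂ {u = _ ∷ _} {t = _ ∷ _} (there p) = there (zip-∈₂ p)

map-suc-injective : ∀ {xs ys} → map suc xs ≡ map suc ys → xs ≡ ys
map-suc-injective = map-injective suc-injective

-- Increasing and gapless lists

IncreasingAbove : ℕ → List ℕ → Set
IncreasingAbove lo [] = ⊤
IncreasingAbove lo (x ∷ xs) = lo < x × IncreasingAbove x xs

Increasing : List ℕ → Set
Increasing = IncreasingAbove 0

IncreasingAbove⇒< : ∀ {lo xs z} → IncreasingAbove lo xs → z ∈ xs → lo < z
IncreasingAbove⇒< (lo<x , _) (here refl) = lo<x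
IncreasingAbove⇒< (lo<x , rest) (there p) = <-trans lo<x (IncreasingAbove⇒< rest p)

IncreasingAbove-weaken : ∀ {lo lo' xs} → lo' ≤ lo → IncreasingAbove lo xs → IncreasingAbove lo' xs
IncreasingAbove-weaken {xs = []} _ _ = tt
IncreasingAbove-weaken {xs = x ∷ xs} lo'≤lo (lo<x , rest) = ≤-<-trans lo'≤lo lo<x , rest

IncreasingAbove-map-suc : ∀ {lo xs} → IncreasingAbove lo xs → IncreasingAbove (suc lo) (map suc xs)
IncreasingAbove-map-suc {xs = []} _ = tt
IncreasingAbove-map-suc {xs = x ∷ xs} (lo<x , rest) = s≤s lo<x , IncreasingAbove-map-suc rest

IncreasingAbove-map-pred : ∀ {lo xs} → IncreasingAbove (suc lo) xs → IncreasingAbove lo (map pred xs)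
IncreasingAbove-map-pred {xs = []} _ = tt
IncreasingAbove-map-pred {xs = suc x ∷ xs} (s≤s lo<x , rest) = lo<x , IncreasingAbove-map-pred rest

Increasing-1∷map-suc : ∀ {xs} → Increasing xs → Increasing (1 ∷ map suc xs)
Increasing-1∷map-suc inc = s≤s z≤n , IncreasingAbove-map-suc inc

Increasing-map-suc : ∀ {xs} → Increasing xs → Increasing (map suc xs)
Increasing-map-suc inc = IncreasingAbove-weaken z≤n (IncreasingAbove-map-suc inc)

map-suc-pred : ∀ {xs} → (∀ {z} → z ∈ xs → 1 ≤ z) → map suc (map pred xs) ≡ xs
map-suc-pred {[]} _ = refl
map-suc-pred {x ∷ xs} positive with positive (here refl)
... | s≤s _ = cong (x ∷_) (map-suc-pred (positive ∘ there))

Increasing-head≢1 : ∀ {x X} → x ≢ 1 → Increasing (x ∷ X) → IncreasingAbove 1 (x ∷ X)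
Increasing-head≢1 x≢1 (0<x , rest) = ≤∧≢⇒< 0<x (x≢1 ∘ sym) , rest

map-suc-pred-above1 : ∀ {xs} → IncreasingAbove 1 xs → map suc (map pred xs) ≡ xs
map-suc-pred-above1 inc = map-suc-pred (λ z∈ → <⇒≤ (IncreasingAbove⇒< inc z∈))

Gapless : List ℕ → Set
Gapless t = ∀ {j} → 1 ≤ j → j ≤ maxL t → j ∈ t

Gapless-resp : ∀ {t t'} → t ⊆ t' → t' ⊆ t → Gapless t → Gapless t'
Gapless-resp t⊆t' t'⊆t gapless 1≤j j≤ = t⊆t' (gapless 1≤j (≤-trans j≤ (≤-reflexive (maxL-cong t'⊆t t⊆t'))))

Gapless-1∷map-suc⁺ : ∀ {t} → Gapless t → Gapless (1 ∷ map suc t)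
Gapless-1∷map-suc⁺ _ {suc zero} _ _ = here refl
Gapless-1∷map-suc⁺ {t} gapless {suc (suc i)} _ j≤ =
  there (∈-map⁺ suc (gapless (s≤s z≤n) (≤-pred (≤-trans j≤ (≤-reflexive (maxL-1∷map-suc t))))))

Gapless-1∷map-suc⁻ : ∀ {t} → Gapless (1 ∷ map suc t) → Gapless t
Gapless-1∷map-suc⁻ {t} gapless {i} 1≤i i≤ with gapless (s≤s z≤n) (≤-trans (s≤s i≤) (≤-reflexive (sym (maxL-1∷map-suc t))))
... | here 1≡suc-i = ⊥-elim (1+n≰n (≤-trans (s≤s 1≤i) (≤-reflexive 1≡suc-i)))
... | there p with ∈-map⁻ suc p
...   | i' , i'∈ , refl = i'∈

IsPacked⇒Gapless : ∀ {t} → IsPacked t → Gapless t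
IsPacked⇒Gapless (_ , letters) 1≤j j≤ = All.lookup letters (∈-range1⁺ 1≤j j≤)

IsPacked⇒positive : ∀ {t z} → IsPacked t → z ∈ t → 1 ≤ z
IsPacked⇒positive (positive , _) z∈ = All.lookup positive z∈

Gapless⇒IsPacked : ∀ {t} → (∀ {z} → z ∈ t → 1 ≤ z) → Gapless t → IsPacked t
Gapless⇒IsPacked positive gapless = All.tabulate positive , All.tabulate (λ j∈ → let (1≤j , j≤) = ∈-range1⁻ j∈ in gapless 1≤j j≤)

Increasing-range1 : ∀ k → Increasing (range1 k)
Increasing-range1 zero = tt
Increasing-range1 (suc k) = subst Increasing (sym (range1-suc k)) (Increasing-1∷map-suc (Increasing-range1 k))

Gapless-range1 : ∀ k → Gapless (range1 k)
Gapless-range1 k 1≤j j≤ = ∈-range1⁺ 1≤j (≤-trans j≤ (≤-reflexive (maxL-range1 k)))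

Gapless⇒maxL≤length : ∀ {t} → Gapless t → maxL t ≤ length t
Gapless⇒maxL≤length gapless = range1⊆⇒≤length λ j∈ → let (1≤j , j≤) = ∈-range1⁻ j∈ in gapless 1≤j j≤

Increasing∧Gapless⇒range1 : ∀ n s → length s ≡ n → Increasing s → Gapless s → s ≡ range1 n
Increasing∧Gapless⇒range1 zero [] _ _ _ = refl
Increasing∧Gapless⇒range1 (suc n) (x ∷ s) len (0<x , inc) gapless =
  trans s≡1∷s' (trans (cong (λ r → 1 ∷ map suc r) IH) (sym (range1-suc n)))
  where
  x≡1 : x ≡ 1
  x≡1 with gapless (s≤s z≤n) (≤-trans 0<x (m≤m⊔n x (maxL s)))
  ... | here 1≡x = sym 1≡x
  ... | there 1∈s = ⊥-elim (1+n≰n (≤-trans (s≤s 0<x) (IncreasingAbove⇒< inc 1∈s)))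
  s' = map pred s
  s≡1∷s' : x ∷ s ≡ 1 ∷ map suc s'
  s≡1∷s' = cong₂ _∷_ x≡1 (sym (map-suc-pred (λ z∈ → <-trans 0<x (IncreasingAbove⇒< inc z∈))))
  IH : s' ≡ range1 n
  IH = Increasing∧Gapless⇒range1 n s' (trans (length-map pred s) (suc-injective len))
         (IncreasingAbove-map-pred (IncreasingAbove-weaken (≤-reflexive (sym x≡1)) inc))
         (Gapless-1∷map-suc⁻ (subst Gapless s≡1∷s' gapless))

nth0 : List ℕ → ℕ → ℕ
nth0 [] _ = 0
nth0 (x ∷ xs) zero = x
nth0 (x ∷ xs) (suc i) = nth0 xs i

-- 1-based lookup; out-of-range indices give the junk value 0
nth1 : List ℕ → ℕ → ℕ
nth1 xs i = nth0 xs (pred i)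

nth0-∈ : ∀ {s i} → i < length s → nth0 s i ∈ s
nth0-∈ {x ∷ s} {zero} _ = here refl
nth0-∈ {x ∷ s} {suc i} (s≤s i<) = there (nth0-∈ i<)

∈⇒nth0 : ∀ {s x} → x ∈ s → Σ ℕ λ i → i < length s × nth0 s i ≡ x
∈⇒nth0 (here refl) = 0 , s≤s z≤n , refl
∈⇒nth0 (there p) with ∈⇒nth0 p
... | i , i< , eq = suc i , s≤s i< , eq

nth1-∈ : ∀ {s i} → 1 ≤ i → i ≤ length s → nth1 s i ∈ s
nth1-∈ {i = suc i} _ i≤ = nth0-∈ i≤

∈⇒nth1 : ∀ {s x} → x ∈ s → Σ ℕ λ i → (1 ≤ i × i ≤ length s) × nth1 s i ≡ x
∈⇒nth1 p with ∈⇒nth0 p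
... | i , i< , eq = suc i , (s≤s z≤n , i<) , eq

nth0-mono : ∀ {lo s i j} → IncreasingAbove lo s → i < j → j < length s → nth0 s i < nth0 s j
nth0-mono {s = x ∷ s} {zero} {suc j} (_ , rest) _ (s≤s j<) = IncreasingAbove⇒< rest (nth0-∈ j<)
nth0-mono {s = x ∷ s} {suc i} {suc j} (_ , rest) (s≤s i<j) (s≤s j<) = nth0-mono rest i<j j<

nth1-mono : ∀ {lo s i j} → IncreasingAbove lo s → 1 ≤ i → i < j → j ≤ length s → nth1 s i < nth1 s j
nth1-mono {i = suc i} {suc j} inc _ (s≤s i<j) j≤ = nth0-mono inc i<j j≤

nth1-map-range1 : ∀ (f : ℕ → ℕ) k i → 1 ≤ i → i ≤ k → nth1 (map f (range1 k)) i ≡ f i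
nth1-map-range1 f (suc k) (suc zero) _ _ = cong (λ r → nth1 r 1) (map-range1-suc f k)
nth1-map-range1 f (suc k) (suc (suc i)) _ (s≤s i≤k) =
  trans (cong (λ r → nth1 r (suc (suc i))) (map-range1-suc f k)) (nth1-map-range1 (f ∘ suc) k (suc i) (s≤s z≤n) i≤k)

nth0-ext : ∀ {s s'} → length s ≡ length s' → (∀ i → i < length s → nth0 s i ≡ nth0 s' i) → s ≡ s'
nth0-ext {[]} {[]} _ _ = refl
nth0-ext {x ∷ s} {y ∷ s'} len eq = cong₂ _∷_ (eq 0 (s≤s z≤n)) (nth0-ext (suc-injective len) (λ i i< → eq (suc i) (s≤s i<)))

nth1-ext : ∀ {s s' k} → length s ≡ k → length s' ≡ k → (∀ i → 1 ≤ i → i ≤ k → nth1 s i ≡ nth1 s' i) → s ≡ s'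
nth1-ext refl len' eq = nth0-ext (sym len') (λ i i< → eq (suc i) (s≤s z≤n) i<)

IncreasingAbove-map-range1 : ∀ (f : ℕ → ℕ) k lo → (∀ i → 1 ≤ i → i < k → f i < f (suc i)) → (1 ≤ k → lo < f 1)
                           → IncreasingAbove lo (map f (range1 k))
IncreasingAbove-map-range1 f zero lo _ _ = tt
IncreasingAbove-map-range1 f (suc k) lo step first = subst (IncreasingAbove lo) (sym (map-range1-suc f k))
  ( first (s≤s z≤n)
  , IncreasingAbove-map-range1 (f ∘ suc) k (f 1) (λ i 1≤i i<k → step (suc i) (s≤s z≤n) (s≤s i<k)) (λ 1≤k → step 1 (s≤s z≤n) (s≤s 1≤k)))

zip-map-range1 : ∀ {a} {A : Set a} (s : List ℕ) (F : ℕ → A) k → length s ≡ k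
               → zip s (map F (range1 k)) ≡ map (λ i → nth1 s i , F i) (range1 k)
zip-map-range1 [] F zero _ = refl
zip-map-range1 (x ∷ s) F (suc k) len = begin
  zip (x ∷ s) (map F (range1 (suc k)))                     ≡⟨ cong (zip (x ∷ s)) (map-range1-suc F k) ⟩
  (x , F 1) ∷ zip s (map (F ∘ suc) (range1 k))             ≡⟨ cong ((x , F 1) ∷_) (zip-map-range1 s (F ∘ suc) k (suc-injective len)) ⟩
  (x , F 1) ∷ map (λ i → nth1 s i , F (suc i)) (range1 k)  ≡⟨ cong ((x , F 1) ∷_) (map-cong-local (All.tabulate shift)) ⟩
  (x , F 1) ∷ map (λ i → nth1 (x ∷ s) (suc i) , F (suc i)) (range1 k)  ≡⟨ sym (map-range1-suc (λ i → nth1 (x ∷ s) i , F i) k) ⟩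
  map (λ i → nth1 (x ∷ s) i , F i) (range1 (suc k))        ∎
  where
  open ≡-Reasoning
  shift : ∀ {i} → i ∈ range1 k → (nth1 s i , F (suc i)) ≡ (nth1 (x ∷ s) (suc i) , F (suc i))
  shift {zero} 0∈ with () ← proj₁ (∈-range1⁻ 0∈)
  shift {suc i} _ = refl

-- Quasi-shuffle index pairs

IndexPair : Set
IndexPair = List ℕ × List ℕ

merged : IndexPair → List ℕ
merged (a , b) = a ++ b

consLeft consRight consBoth : IndexPair → IndexPair
consLeft (a , b) = 1 ∷ map suc a , map suc b
consRight (a , b) = map suc a , 1 ∷ map suc b
consBoth (a , b) = 1 ∷ map suc a , 1 ∷ map suc b

-- (s₁ , s₂) indexes the quasi-shuffle term of b₁⋯b_k and c₁⋯c_l whose letter at position s₁(i) has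
-- the factor bᵢ and at position s₂(j) the factor cⱼ; the three cons's mirror the recursion of qsh.
quasiShuffles : ℕ → ℕ → List IndexPair
quasiShuffles zero l = ([] , range1 l) ∷ []
quasiShuffles (suc k) zero = (range1 (suc k) , []) ∷ []
quasiShuffles (suc k) (suc l) =
  map consLeft (quasiShuffles k (suc l)) ++ map consRight (quasiShuffles (suc k) l) ++ map consBoth (quasiShuffles k l)

record IsQuasiShuffle (k l : ℕ) (σ : IndexPair) : Set where
  field
    length₁     : length (proj₁ σ) ≡ k
    length₂     : length (proj₂ σ) ≡ l
    increasing₁ : Increasing (proj₁ σ)
    increasing₂ : Increasing (proj₂ σ)
    gapless     : Gapless (merged σ)

record ShiftsMerged (cons : IndexPair → IndexPair) : Set where
  field
    merged-⊆ : ∀ σ → merged (cons σ) ⊆ 1 ∷ map suc (merged σ)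
    merged-⊇ : ∀ σ → 1 ∷ map suc (merged σ) ⊆ merged (cons σ)

consLeft-shiftsMerged : ShiftsMerged consLeft
consLeft-shiftsMerged = record { merged-⊆ = λ σ → subst (_∈_ _) (eq σ) ; merged-⊇ = λ σ → subst (_∈_ _) (sym (eq σ)) }
  where
  eq : ∀ σ → merged (consLeft σ) ≡ 1 ∷ map suc (merged σ)
  eq (a , b) = cong (1 ∷_) (sym (map-++ suc a b))

consRight-shiftsMerged : ShiftsMerged consRight
consRight-shiftsMerged = record { merged-⊆ = to ; merged-⊇ = from }
  where
  to : ∀ σ → merged (consRight σ) ⊆ 1 ∷ map suc (merged σ)
  to (a , b) j∈ with ∈-++⁻ (map suc a) j∈
  ... | inj₁ p = there (subst (_ ∈_) (sym (map-++ suc a b)) (∈-++⁺ˡ p))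
  ... | inj₂ (here refl) = here refl
  ... | inj₂ (there p) = there (subst (_ ∈_) (sym (map-++ suc a b)) (∈-++⁺ʳ (map suc a) p))
  from : ∀ σ → 1 ∷ map suc (merged σ) ⊆ merged (consRight σ)
  from (a , b) (here refl) = ∈-++⁺ʳ (map suc a) (here refl)
  from (a , b) (there j∈) with ∈-++⁻ (map suc a) (subst (_ ∈_) (map-++ suc a b) j∈)
  ... | inj₁ p = ∈-++⁺ˡ p
  ... | inj₂ p = ∈-++⁺ʳ (map suc a) (there p)

consBoth-shiftsMerged : ShiftsMerged consBoth
consBoth-shiftsMerged = record { merged-⊆ = to ; merged-⊇ = λ σ → there ∘ merged-⊇ σ }
  where
  open ShiftsMerged consRight-shiftsMerged
  to : ∀ σ → merged (consBoth σ) ⊆ 1 ∷ map suc (merged σ)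
  to σ (here refl) = here refl
  to σ (there j∈) = merged-⊆ σ j∈

module _ {cons : IndexPair → IndexPair} (shifts : ShiftsMerged cons) (σ : IndexPair) where
  open ShiftsMerged shifts

  maxL-merged-cons : maxL (merged (cons σ)) ≡ suc (maxL (merged σ))
  maxL-merged-cons = trans (maxL-cong (merged-⊆ σ) (merged-⊇ σ)) (maxL-1∷map-suc (merged σ))

  Gapless-merged-cons⁺ : Gapless (merged σ) → Gapless (merged (cons σ))
  Gapless-merged-cons⁺ = Gapless-resp (merged-⊇ σ) (merged-⊆ σ) ∘ Gapless-1∷map-suc⁺

  Gapless-merged-cons⁻ : Gapless (merged (cons σ)) → Gapless (merged σ)
  Gapless-merged-cons⁻ = Gapless-1∷map-suc⁻ ∘ Gapless-resp (merged-⊆ σ) (merged-⊇ σ)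

module _ {k l : ℕ} {a b : List ℕ} (qs : IsQuasiShuffle k l (a , b)) where
  open IsQuasiShuffle qs

  consLeft-isQuasiShuffle : IsQuasiShuffle (suc k) l (consLeft (a , b))
  consLeft-isQuasiShuffle = record
    { length₁ = cong suc (trans (length-map suc a) length₁) ; length₂ = trans (length-map suc b) length₂
    ; increasing₁ = Increasing-1∷map-suc increasing₁ ; increasing₂ = Increasing-map-suc increasing₂
    ; gapless = Gapless-merged-cons⁺ consLeft-shiftsMerged (a , b) gapless }

  consRight-isQuasiShuffle : IsQuasiShuffle k (suc l) (consRight (a , b))
  consRight-isQuasiShuffle = record
    { length₁ = trans (length-map suc a) length₁ ; length₂ = cong suc (trans (length-map suc b) length₂)
    ; increasing₁ = Increasing-map-suc increasing₁ ; increasing₂ = Increasing-1∷map-suc increasing₂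
    ; gapless = Gapless-merged-cons⁺ consRight-shiftsMerged (a , b) gapless }

  consBoth-isQuasiShuffle : IsQuasiShuffle (suc k) (suc l) (consBoth (a , b))
  consBoth-isQuasiShuffle = record
    { length₁ = cong suc (trans (length-map suc a) length₁) ; length₂ = cong suc (trans (length-map suc b) length₂)
    ; increasing₁ = Increasing-1∷map-suc increasing₁ ; increasing₂ = Increasing-1∷map-suc increasing₂
    ; gapless = Gapless-merged-cons⁺ consBoth-shiftsMerged (a , b) gapless }

quasiShuffles-sound : ∀ k l → All (IsQuasiShuffle k l) (quasiShuffles k l)
quasiShuffles-sound zero l = record
  { length₁ = refl ; length₂ = length-range1 l ; increasing₁ = tt ; increasing₂ = Increasing-range1 l
  ; gapless = Gapless-range1 l } ∷ []
quasiShuffles-sound (suc k) zero = record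
  { length₁ = length-range1 (suc k) ; length₂ = refl ; increasing₁ = Increasing-range1 (suc k) ; increasing₂ = tt
  ; gapless = subst Gapless (sym (++-identityʳ (range1 (suc k)))) (Gapless-range1 (suc k)) } ∷ []
quasiShuffles-sound (suc k) (suc l) =
  All.++⁺ (All.map⁺ (All.map consLeft-isQuasiShuffle (quasiShuffles-sound k (suc l))))
  (All.++⁺ (All.map⁺ (All.map consRight-isQuasiShuffle (quasiShuffles-sound (suc k) l)))
           (All.map⁺ (All.map consBoth-isQuasiShuffle (quasiShuffles-sound k l))))

unshift-isQuasiShuffle : ∀ {cons k l a b} → ShiftsMerged cons → IncreasingAbove 1 a → IncreasingAbove 1 b
                       → length a ≡ k → length b ≡ l → Gapless (merged (cons (map pred a , map pred b)))
                       → IsQuasiShuffle k l (map pred a , map pred b)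
unshift-isQuasiShuffle {a = a} {b} shifts inc₁ inc₂ len₁ len₂ gapless = record
  { length₁ = trans (length-map pred a) len₁ ; length₂ = trans (length-map pred b) len₂
  ; increasing₁ = IncreasingAbove-map-pred inc₁ ; increasing₂ = IncreasingAbove-map-pred inc₂
  ; gapless = Gapless-merged-cons⁻ shifts _ gapless }

quasiShuffles-complete : ∀ k l σ → IsQuasiShuffle k l σ → σ ∈ quasiShuffles k l
quasiShuffles-complete zero l ([] , b) qs =
  here (cong ([] ,_) (Increasing∧Gapless⇒range1 l b length₂ increasing₂ gapless))
  where open IsQuasiShuffle qs
quasiShuffles-complete (suc k) zero (a , []) qs =
  here (cong (_, []) (Increasing∧Gapless⇒range1 (suc k) a length₁ increasing₁ (subst Gapless (++-identityʳ a) gapless)))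
  where open IsQuasiShuffle qs
quasiShuffles-complete (suc k) (suc l) (x ∷ X , y ∷ Y) qs with x ≟ 1 | y ≟ 1
... | yes refl | no y≢1 = subst (_∈ quasiShuffles (suc k) (suc l)) σ≡ (∈-++⁺ˡ (∈-map⁺ consLeft (quasiShuffles-complete k (suc l) _ qs')))
  where
  open IsQuasiShuffle qs
  σ≡ : consLeft (map pred X , map pred (y ∷ Y)) ≡ (1 ∷ X , y ∷ Y)
  σ≡ = cong₂ _,_ (cong (1 ∷_) (map-suc-pred-above1 (proj₂ increasing₁))) (map-suc-pred-above1 (Increasing-head≢1 y≢1 increasing₂))
  qs' = unshift-isQuasiShuffle consLeft-shiftsMerged (proj₂ increasing₁) (Increasing-head≢1 y≢1 increasing₂)
          (suc-injective length₁) length₂ (subst (Gapless ∘ merged) (sym σ≡) gapless)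
... | no x≢1 | yes refl = subst (_∈ quasiShuffles (suc k) (suc l)) σ≡
  (∈-++⁺ʳ (map consLeft (quasiShuffles k (suc l))) (∈-++⁺ˡ (∈-map⁺ consRight (quasiShuffles-complete (suc k) l _ qs'))))
  where
  open IsQuasiShuffle qs
  σ≡ : consRight (map pred (x ∷ X) , map pred Y) ≡ (x ∷ X , 1 ∷ Y)
  σ≡ = cong₂ _,_ (map-suc-pred-above1 (Increasing-head≢1 x≢1 increasing₁)) (cong (1 ∷_) (map-suc-pred-above1 (proj₂ increasing₂)))
  qs' = unshift-isQuasiShuffle consRight-shiftsMerged (Increasing-head≢1 x≢1 increasing₁) (proj₂ increasing₂)
          length₁ (suc-injective length₂) (subst (Gapless ∘ merged) (sym σ≡) gapless)
... | yes refl | yes refl = subst (_∈ quasiShuffles (suc k) (suc l)) σ≡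
  (∈-++⁺ʳ (map consLeft (quasiShuffles k (suc l))) (∈-++⁺ʳ (map consRight (quasiShuffles (suc k) l))
    (∈-map⁺ consBoth (quasiShuffles-complete k l _ qs'))))
  where
  open IsQuasiShuffle qs
  σ≡ : consBoth (map pred X , map pred Y) ≡ (1 ∷ X , 1 ∷ Y)
  σ≡ = cong₂ _,_ (cong (1 ∷_) (map-suc-pred-above1 (proj₂ increasing₁))) (cong (1 ∷_) (map-suc-pred-above1 (proj₂ increasing₂)))
  qs' = unshift-isQuasiShuffle consBoth-shiftsMerged (proj₂ increasing₁) (proj₂ increasing₂)
          (suc-injective length₁) (suc-injective length₂) (subst (Gapless ∘ merged) (sym σ≡) gapless)
... | no x≢1 | no y≢1 = ⊥-elim (1∉ (gapless (s≤s z≤n) (≤-trans (proj₁ increasing₁) (m≤m⊔n x _))))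
  where
  open IsQuasiShuffle qs
  1∉ : 1 ∉ (x ∷ X) ++ (y ∷ Y)
  1∉ 1∈ with ∈-++⁻ (x ∷ X) 1∈
  ... | inj₁ 1∈ = <-irrefl refl (IncreasingAbove⇒< (Increasing-head≢1 x≢1 increasing₁) 1∈)
  ... | inj₂ 1∈ = <-irrefl refl (IncreasingAbove⇒< (Increasing-head≢1 y≢1 increasing₂) 1∈)

1∷≢map-suc : ∀ {a xs} → Increasing a → 1 ∷ xs ≢ map suc a
1∷≢map-suc {z ∷ a} (s≤s z≤n , _) ()

consLeft-injective : ∀ {σ σ'} → consLeft σ ≡ consLeft σ' → σ ≡ σ'
consLeft-injective {_ , _} {_ , _} eq =
  cong₂ _,_ (map-suc-injective (∷-injectiveʳ (cong proj₁ eq))) (map-suc-injective (cong proj₂ eq))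

consRight-injective : ∀ {σ σ'} → consRight σ ≡ consRight σ' → σ ≡ σ'
consRight-injective {_ , _} {_ , _} eq =
  cong₂ _,_ (map-suc-injective (cong proj₁ eq)) (map-suc-injective (∷-injectiveʳ (cong proj₂ eq)))

consBoth-injective : ∀ {σ σ'} → consBoth σ ≡ consBoth σ' → σ ≡ σ'
consBoth-injective {_ , _} {_ , _} eq =
  cong₂ _,_ (map-suc-injective (∷-injectiveʳ (cong proj₁ eq))) (map-suc-injective (∷-injectiveʳ (cong proj₂ eq)))

-- The three blocks of quasiShuffles are told apart by which components start with the letter 1.
quasiShuffles-unique : ∀ k l → Unique (quasiShuffles k l)
quasiShuffles-unique zero l = [] ∷ []
quasiShuffles-unique (suc k) zero = [] ∷ []
quasiShuffles-unique (suc k) (suc l) =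
  Unique.++⁺ (Unique.map⁺ consLeft-injective (quasiShuffles-unique k (suc l)))
    (Unique.++⁺ (Unique.map⁺ consRight-injective (quasiShuffles-unique (suc k) l))
                (Unique.map⁺ consBoth-injective (quasiShuffles-unique k l)) right#both)
    left#rest
  where
  increasing₁ : ∀ k l {σ} → σ ∈ quasiShuffles k l → Increasing (proj₁ σ)
  increasing₁ k l σ∈ = IsQuasiShuffle.increasing₁ (All.lookup (quasiShuffles-sound k l) σ∈)
  increasing₂ : ∀ k l {σ} → σ ∈ quasiShuffles k l → Increasing (proj₂ σ)
  increasing₂ k l σ∈ = IsQuasiShuffle.increasing₂ (All.lookup (quasiShuffles-sound k l) σ∈)
  right#both : Disjoint (map consRight (quasiShuffles (suc k) l)) (map consBoth (quasiShuffles k l))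
  right#both (p , q) with ∈-map⁻ consRight p | ∈-map⁻ consBoth q
  ... | _ , σ∈ , refl | (_ , _) , _ , eq = 1∷≢map-suc (increasing₁ (suc k) l σ∈) (sym (cong proj₁ eq))
  left#rest : Disjoint (map consLeft (quasiShuffles k (suc l))) (map consRight (quasiShuffles (suc k) l) ++ map consBoth (quasiShuffles k l))
  left#rest (p , q) with ∈-map⁻ consLeft p | ∈-++⁻ (map consRight (quasiShuffles (suc k) l)) q
  ... | (_ , _) , _ , refl | inj₁ q' with ∈-map⁻ consRight q'
  ...   | (_ , _) , σ'∈ , eq = 1∷≢map-suc (increasing₁ (suc k) l σ'∈) (cong proj₁ eq)
  left#rest (p , q) | _ , σ∈ , refl | inj₂ q' with ∈-map⁻ consBoth q'
  ...   | (_ , _) , _ , eq = 1∷≢map-suc (increasing₂ k (suc l) σ∈) (sym (cong proj₂ eq))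

-- Packing

record Onto (u : List ℕ) (k : ℕ) : Set where
  field
    bounded : ∀ {y} → y ∈ u → 1 ≤ y × y ≤ k
    onto    : ∀ {y} → 1 ≤ y → y ≤ k → y ∈ u

IsPacked⇒Onto : ∀ {u} → IsPacked u → Onto u (maxL u)
IsPacked⇒Onto packed = record { bounded = λ y∈ → IsPacked⇒positive packed y∈ , ∈⇒≤maxL y∈ ; onto = IsPacked⇒Gapless packed }

Onto⇒≤length : ∀ {u k} → Onto u k → k ≤ length u
Onto⇒≤length onto-k = range1⊆⇒≤length λ j∈ → let (1≤j , j≤k) = ∈-range1⁻ j∈ in Onto.onto onto-k 1≤j j≤k

IncreasingOn : ℕ → (ℕ → ℕ) → Set
IncreasingOn k g = ∀ {z y} → 1 ≤ z → z < y → y ≤ k → g z < g y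

module _ {k g} (increasing : IncreasingOn k g) {z y} (1≤z : 1 ≤ z) (z≤k : z ≤ k) (1≤y : 1 ≤ y) (y≤k : y ≤ k) where

  IncreasingOn-reflects-< : g z < g y → z < y
  IncreasingOn-reflects-< gz<gy with <-cmp z y
  ... | tri< z<y _ _ = z<y
  ... | tri≈ _ refl _ = ⊥-elim (<-irrefl refl gz<gy)
  ... | tri> _ _ y<z = ⊥-elim (<-asym gz<gy (increasing 1≤y y<z z≤k))

  IncreasingOn-injective : g z ≡ g y → z ≡ y
  IncreasingOn-injective gz≡gy with <-cmp z y
  ... | tri< z<y _ _ = ⊥-elim (<-irrefl gz≡gy (increasing 1≤z z<y y≤k))
  ... | tri≈ _ z≡y _ = z≡y
  ... | tri> _ _ y<z = ⊥-elim (<-irrefl (sym gz≡gy) (increasing 1≤y y<z z≤k))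

-- pack w is definitionally map (λ x → suc (rank x w)) w
rank : ℕ → List ℕ → ℕ
rank x w = length (deduplicate _≟_ (filter (_<? x) w))

pack-map-increasing : ∀ {u k} (g : ℕ → ℕ) → Onto u k → IncreasingOn k g → pack (map g u) ≡ u
pack-map-increasing {u} {k} g onto-k increasing =
  trans (sym (map-∘ u)) (trans (map-cong-local (All.tabulate rank-g)) (map-id u))
  where
  open Onto onto-k
  rank-g : ∀ {y} → y ∈ u → suc (rank (g y) (map g u)) ≡ y
  rank-g {zero} y∈ = ⊥-elim (1+n≰n (proj₁ (bounded y∈)))
  rank-g {suc y} y∈ = cong suc (begin
    length below                    ≡⟨ Unique-⊆⊇⇒length≡ (deduplicate-! _) unique-g-range1 below⊆ ⊆below ⟩
    length (map g (range1 y))       ≡⟨ length-map g (range1 y) ⟩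
    length (range1 y)               ≡⟨ length-range1 y ⟩
    y                               ∎)
    where
    open ≡-Reasoning
    y≤k = proj₂ (bounded y∈)
    below = deduplicate _≟_ (filter (_<? g (suc y)) (map g u))
    ≤y⇒≤k : ∀ {z} → z ≤ y → z ≤ k
    ≤y⇒≤k z≤y = ≤-trans z≤y (≤-trans (n≤1+n y) y≤k)
    unique-g-range1 : Unique (map g (range1 y))
    unique-g-range1 = Unique-map-injectiveOn g (unique-range1 y) λ a∈ b∈ →
      let (1≤a , a≤) = ∈-range1⁻ a∈ ; (1≤b , b≤) = ∈-range1⁻ b∈ in
      IncreasingOn-injective increasing 1≤a (≤y⇒≤k a≤) 1≤b (≤y⇒≤k b≤)
    below⊆ : below ⊆ map g (range1 y)
    below⊆ z∈ with ∈-filter⁻ (_<? g (suc y)) {xs = map g u} (∈-deduplicate⁻ _≟_ (filter (_<? g (suc y)) (map g u)) z∈)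
    ... | z∈' , gz<gy with ∈-map⁻ g z∈'
    ...   | y' , y'∈ , refl = let (1≤y' , y'≤k) = bounded y'∈ in
      ∈-map⁺ g (∈-range1⁺ 1≤y' (≤-pred (IncreasingOn-reflects-< increasing 1≤y' y'≤k (s≤s z≤n) y≤k gz<gy)))
    ⊆below : map g (range1 y) ⊆ below
    ⊆below z∈ with ∈-map⁻ g z∈
    ... | y' , y'∈ , refl = let (1≤y' , y'≤y) = ∈-range1⁻ y'∈ in
      ∈-deduplicate⁺ _≟_ {filter (_<? g (suc y)) (map g u)}
        (∈-filter⁺ (_<? g (suc y)) (∈-map⁺ g (onto 1≤y' (≤y⇒≤k y'≤y))) (increasing 1≤y' (s≤s y'≤y) y≤k))

rank-mono : ∀ {x y t} → x < y → x ∈ t → rank x t < rank y t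
rank-mono {x} {y} {t} x<y x∈t = Unique-⊆⇒length≤ (x∉below ∷ deduplicate-! _) x∷below⊆
  where
  below : ℕ → List ℕ
  below z = deduplicate _≟_ (filter (_<? z) t)
  x∉below : All (λ z → x ≢ z) (below x)
  x∉below = All.tabulate λ z∈ x≡z → <-irrefl (sym x≡z) (proj₂ (∈-filter⁻ (_<? x) {xs = t} (∈-deduplicate⁻ _≟_ (filter (_<? x) t) z∈)))
  x∷below⊆ : x ∷ below x ⊆ below y
  x∷below⊆ (here refl) = ∈-deduplicate⁺ _≟_ {filter (_<? y) t} (∈-filter⁺ (_<? y) x∈t x<y)
  x∷below⊆ (there z∈) with ∈-filter⁻ (_<? x) {xs = t} (∈-deduplicate⁻ _≟_ (filter (_<? x) t) z∈)
  ... | z∈t , z<x = ∈-deduplicate⁺ _≟_ {filter (_<? y) t} (∈-filter⁺ (_<? y) z∈t (<-trans z<x x<y))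

zip-map-∈ : ∀ (h : ℕ → ℕ) t {i a} → (i , a) ∈ zip (map h t) t → i ≡ h a × a ∈ t
zip-map-∈ h (x ∷ t) (here refl) = refl , here refl
zip-map-∈ h (x ∷ t) (there p) with zip-map-∈ h t p
... | i≡ha , a∈t = i≡ha , there a∈t

zip-pack-< : ∀ t {i i' a a'} → (i , a) ∈ zip (pack t) t → (i' , a') ∈ zip (pack t) t → i < i' → a < a'
zip-pack-< t p p' i<i' with zip-map-∈ (λ x → suc (rank x t)) t p | zip-map-∈ (λ x → suc (rank x t)) t p'
... | refl , a∈t | refl , a'∈t with <-cmp _ _
...   | tri< a<a' _ _ = a<a'
...   | tri≈ _ refl _ = ⊥-elim (<-irrefl refl i<i')
...   | tri> _ _ a'<a = ⊥-elim (<-asym i<i' (s≤s (rank-mono a'<a a'∈t)))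

ZipFunctional : List ℕ → List ℕ → Set
ZipFunctional u t = ∀ {i a b} → (i , a) ∈ zip u t → (i , b) ∈ zip u t → a ≡ b

zip-pack-functional : ∀ t → ZipFunctional (pack t) t
zip-pack-functional t {i} {a} {b} p p' with zip-map-∈ (λ x → suc (rank x t)) t p | zip-map-∈ (λ x → suc (rank x t)) t p'
... | i≡ , a∈t | i≡' , b∈t with <-cmp a b
...   | tri< a<b _ _ = ⊥-elim (<-irrefl (suc-injective (trans (sym i≡) i≡')) (rank-mono a<b a∈t))
...   | tri≈ _ a≡b _ = a≡b
...   | tri> _ _ b<a = ⊥-elim (<-irrefl (suc-injective (trans (sym i≡') i≡)) (rank-mono b<a b∈t))

-- junk value 0 if i does not occur in u
letterAt : List ℕ → List ℕ → ℕ → ℕ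
letterAt (x ∷ u) (a ∷ t) i with x ≟ i
... | yes _ = a
... | no _ = letterAt u t i
letterAt _ _ _ = 0

letterAt-∈ : ∀ u t {i} → length u ≡ length t → i ∈ u → (i , letterAt u t i) ∈ zip u t
letterAt-∈ (x ∷ u) (a ∷ t) {i} len i∈ with x ≟ i
... | yes x≡i = here (cong (_, a) (sym x≡i))
... | no x≢i with i∈
...   | here i≡x = ⊥-elim (x≢i (sym i≡x))
...   | there p = there (letterAt-∈ u t (suc-injective len) p)

map-letterAt : ∀ u t → length u ≡ length t → ZipFunctional u t → map (letterAt u t) u ≡ t
map-letterAt [] [] _ _ = refl
map-letterAt (x ∷ u) (a ∷ t) len functional =
  cong₂ _∷_ head (trans (map-cong-local (All.tabulate tail)) (map-letterAt u t (suc-injective len) (λ p q → functional (there p) (there q))))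
  where
  head : letterAt (x ∷ u) (a ∷ t) x ≡ a
  head with x ≟ x
  ... | yes _ = refl
  ... | no x≢x = ⊥-elim (x≢x refl)
  tail : ∀ {y} → y ∈ u → letterAt (x ∷ u) (a ∷ t) y ≡ letterAt u t y
  tail {y} y∈ with x ≟ y
  ... | yes refl = functional (here refl) (there (letterAt-∈ u t (suc-injective len) y∈))
  ... | no _ = refl

-- A word t with pack t onto {1..k} is map (nth1 letters) (pack t) for the increasing list of its letters.
module Unpack (t : List ℕ) {k} (onto-k : Onto (pack t) k) (positive : ∀ {a} → a ∈ t → 1 ≤ a) where
  open Onto onto-k

  private
    length-pack : length (pack t) ≡ length t
    length-pack = length-map _ t

    zip-letterAt : ∀ {i} → 1 ≤ i → i ≤ k → (i , letterAt (pack t) t i) ∈ zip (pack t) t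
    zip-letterAt 1≤i i≤k = letterAt-∈ (pack t) t length-pack (onto 1≤i i≤k)

    map-letterAt-pack : map (letterAt (pack t) t) (pack t) ≡ t
    map-letterAt-pack = map-letterAt (pack t) t length-pack (zip-pack-functional t)

  letters : List ℕ
  letters = map (letterAt (pack t) t) (range1 k)

  length-letters : length letters ≡ k
  length-letters = trans (length-map _ (range1 k)) (length-range1 k)

  increasing : Increasing letters
  increasing = IncreasingAbove-map-range1 (letterAt (pack t) t) k 0
    (λ i 1≤i i<k → zip-pack-< t (zip-letterAt 1≤i (<⇒≤ i<k)) (zip-letterAt (s≤s z≤n) i<k) ≤-refl)
    (λ 1≤k → positive (zip-∈₂ (zip-letterAt ≤-refl 1≤k)))

  map-nth1-letters : map (nth1 letters) (pack t) ≡ t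
  map-nth1-letters = trans (map-cong-local (All.tabulate λ {y} y∈ → let (1≤y , y≤k) = bounded y∈ in nth1-map-range1 _ k y 1≤y y≤k))
                           map-letterAt-pack

  letters⊆ : letters ⊆ t
  letters⊆ z∈ with ∈-map⁻ (letterAt (pack t) t) z∈
  ... | i , i∈ , refl = let (1≤i , i≤k) = ∈-range1⁻ i∈ in zip-∈₂ (zip-letterAt 1≤i i≤k)

  ⊆letters : t ⊆ letters
  ⊆letters z∈ with ∈-map⁻ (letterAt (pack t) t) (subst (_ ∈_) (sym map-letterAt-pack) z∈)
  ... | y , y∈ , refl = let (1≤y , y≤k) = bounded y∈ in ∈-map⁺ (letterAt (pack t) t) (∈-range1⁺ 1≤y y≤k)

module Relabel {u k} (onto-k : Onto u k) {s} (length-s : length s ≡ k) (increasing : Increasing s) where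
  open Onto onto-k

  pack-relabel : pack (map (nth1 s) u) ≡ u
  pack-relabel = pack-map-increasing (nth1 s) onto-k λ 1≤z z<y y≤k → nth1-mono increasing 1≤z z<y (≤-trans y≤k (≤-reflexive (sym length-s)))

  relabel⊆ : map (nth1 s) u ⊆ s
  relabel⊆ z∈ with ∈-map⁻ (nth1 s) z∈
  ... | y , y∈ , refl = let (1≤y , y≤k) = bounded y∈ in nth1-∈ 1≤y (≤-trans y≤k (≤-reflexive (sym length-s)))

  ⊆relabel : s ⊆ map (nth1 s) u
  ⊆relabel z∈ with ∈⇒nth1 z∈
  ... | i , (1≤i , i≤) , refl = ∈-map⁺ (nth1 s) (onto 1≤i (≤-trans i≤ (≤-reflexive length-s)))

relabel-injective : ∀ {u k s s'} → Onto u k → length s ≡ k → length s' ≡ k → map (nth1 s) u ≡ map (nth1 s') u → s ≡ s'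
relabel-injective onto-k len len' eq = nth1-ext len len' λ i 1≤i i≤k → map-cong⁻ eq (Onto.onto onto-k 1≤i i≤k)
  where
  map-cong⁻ : ∀ {f g : ℕ → ℕ} {xs y} → map f xs ≡ map g xs → y ∈ xs → f y ≡ g y
  map-cong⁻ eq (here refl) = ∷-injectiveˡ eq
  map-cong⁻ eq (there p) = map-cong⁻ (∷-injectiveʳ eq) p

-- The packed words of M_u M_v

wordsOf-length : ∀ n N {w} → w ∈ wordsOf n N → length w ≡ n
wordsOf-length zero N (here refl) = refl
wordsOf-length (suc n) N w∈ with ∈-concat⁻′ (map (λ a → map (a ∷_) (wordsOf n N)) (range1 N)) w∈
... | ws , w∈ws , ws∈ with ∈-map⁻ (λ a → map (a ∷_) (wordsOf n N)) ws∈
...   | a , _ , refl with ∈-map⁻ (a ∷_) w∈ws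
...     | w' , w'∈ , refl = cong suc (wordsOf-length n N w'∈)

∈-wordsOf : ∀ n N {w} → length w ≡ n → All (λ a → 1 ≤ a × a ≤ N) w → w ∈ wordsOf n N
∈-wordsOf zero N {[]} _ _ = here refl
∈-wordsOf (suc n) N {a ∷ w} len ((1≤a , a≤N) ∷ bounded) =
  ∈-concat⁺′ (∈-map⁺ (a ∷_) (∈-wordsOf n N (suc-injective len) bounded)) (∈-map⁺ (λ a → map (a ∷_) (wordsOf n N)) (∈-range1⁺ 1≤a a≤N))

wordsOf-unique : ∀ n N → Unique (wordsOf n N)
wordsOf-unique zero N = [] ∷ []
wordsOf-unique (suc n) N = prefixAll (range1 N) (unique-range1 N)
  where
  prefixAll : ∀ R → Unique R → Unique (concatMap (λ a → map (a ∷_) (wordsOf n N)) R)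
  prefixAll [] _ = []
  prefixAll (a ∷ R) (a∉R ∷ uniqueR) =
    Unique.++⁺ (Unique.map⁺ ∷-injectiveʳ (wordsOf-unique n N)) (prefixAll R uniqueR) disjoint
    where
    disjoint : Disjoint (map (a ∷_) (wordsOf n N)) (concatMap (λ a → map (a ∷_) (wordsOf n N)) R)
    disjoint (p , q) with ∈-map⁻ (a ∷_) p | ∈-concat⁻′ (map (λ a → map (a ∷_) (wordsOf n N)) R) q
    ... | _ , _ , refl | ws , w∈ws , ws∈ with ∈-map⁻ (λ a → map (a ∷_) (wordsOf n N)) ws∈
    ...   | b , b∈R , refl with ∈-map⁻ (b ∷_) w∈ws
    ...     | _ , _ , eq = All.lookup a∉R b∈R (∷-injectiveˡ eq)

module Relabelling {u v} (packed-u : IsPacked u) (packed-v : IsPacked v) where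
  k = maxL u
  l = maxL v
  n = length u
  N = length u + length v

  onto-u : Onto u k
  onto-u = IsPacked⇒Onto packed-u
  onto-v : Onto v l
  onto-v = IsPacked⇒Onto packed-v

  relabel : IndexPair → List ℕ
  relabel (s₁ , s₂) = map (nth1 s₁) u ++ map (nth1 s₂) v

  -- definitionally the filter predicate of MProd
  inMProd? : (w : List ℕ) → Dec (IsPacked w × pack (take n w) ≡ u × pack (drop n w) ≡ v)
  inMProd? w = isPacked? w ×-dec ((pack (take n w) ≟L u) ×-dec (pack (drop n w) ≟L v))

  module _ {σ} (qs : IsQuasiShuffle k l σ) where
    open IsQuasiShuffle qs
    private
      module R₁ = Relabel onto-u length₁ increasing₁
      module R₂ = Relabel onto-v length₂ increasing₂

    relabel⊆merged : relabel σ ⊆ merged σ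
    relabel⊆merged = ⊆.++⁺ R₁.relabel⊆ R₂.relabel⊆

    merged⊆relabel : merged σ ⊆ relabel σ
    merged⊆relabel = ⊆.++⁺ R₁.⊆relabel R₂.⊆relabel

    relabel∈MProd : relabel σ ∈ MProd u v
    relabel∈MProd = ∈-filter⁺ inMProd? (∈-wordsOf N N length-relabel (All.tabulate bounded)) (packed , pack-take , pack-drop)
      where
      left = map (nth1 (proj₁ σ)) u
      length-left : length left ≡ n
      length-left = length-map _ u
      length-relabel : length (relabel σ) ≡ N
      length-relabel = trans (length-++ left) (cong₂ _+_ length-left (length-map _ v))
      positive : ∀ {z} → z ∈ relabel σ → 1 ≤ z
      positive z∈ with ∈-++⁻ (proj₁ σ) (relabel⊆merged z∈)
      ... | inj₁ p = IncreasingAbove⇒< increasing₁ p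
      ... | inj₂ p = IncreasingAbove⇒< increasing₂ p
      maxL≤N : maxL (merged σ) ≤ N
      maxL≤N = ≤-trans (Gapless⇒maxL≤length gapless)
                 (≤-trans (≤-reflexive (trans (length-++ (proj₁ σ)) (cong₂ _+_ length₁ length₂)))
                   (+-mono-≤ (Onto⇒≤length onto-u) (Onto⇒≤length onto-v)))
      bounded : ∀ {z} → z ∈ relabel σ → 1 ≤ z × z ≤ N
      bounded z∈ = positive z∈ , ≤-trans (∈⇒≤maxL (relabel⊆merged z∈)) maxL≤N
      packed : IsPacked (relabel σ)
      packed = Gapless⇒IsPacked positive (Gapless-resp merged⊆relabel relabel⊆merged gapless)
      pack-take : pack (take n (relabel σ)) ≡ u
      pack-take = trans (cong (λ m → pack (take m (relabel σ))) (sym length-left)) (trans (cong pack (take-length-++ left _)) R₁.pack-relabel)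
      pack-drop : pack (drop n (relabel σ)) ≡ v
      pack-drop = trans (cong (λ m → pack (drop m (relabel σ))) (sym length-left)) (trans (cong pack (drop-length-++ left _)) R₂.pack-relabel)

  MProd⇒relabel : ∀ {t} → t ∈ MProd u v → Σ IndexPair λ σ → σ ∈ quasiShuffles k l × t ≡ relabel σ
  MProd⇒relabel {t} t∈ with ∈-filter⁻ inMProd? {xs = wordsOf N N} t∈
  ... | _ , packed , pack-take , pack-drop = (U₁.letters , U₂.letters) , quasiShuffles-complete k l _ qs , t≡
    where
    t₁ = take n t
    t₂ = drop n t
    t₁++t₂ : t₁ ++ t₂ ≡ t
    t₁++t₂ = take++drop≡id n t
    positive : ∀ {a} → a ∈ t₁ ++ t₂ → 1 ≤ a
    positive a∈ = IsPacked⇒positive packed (subst (_ ∈_) t₁++t₂ a∈)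
    module U₁ = Unpack t₁ (subst (λ w → Onto w k) (sym pack-take) onto-u) (positive ∘ ∈-++⁺ˡ)
    module U₂ = Unpack t₂ (subst (λ w → Onto w l) (sym pack-drop) onto-v) (positive ∘ ∈-++⁺ʳ t₁)
    qs : IsQuasiShuffle k l (U₁.letters , U₂.letters)
    qs = record
      { length₁ = U₁.length-letters ; length₂ = U₂.length-letters
      ; increasing₁ = U₁.increasing ; increasing₂ = U₂.increasing
      ; gapless = Gapless-resp (⊆.++⁺ U₁.⊆letters U₂.⊆letters) (⊆.++⁺ U₁.letters⊆ U₂.letters⊆)
                    (subst Gapless (sym t₁++t₂) (IsPacked⇒Gapless packed)) }
    t≡ : t ≡ relabel (U₁.letters , U₂.letters)
    t≡ = trans (sym t₁++t₂) (cong₂ _++_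
           (sym (subst (λ w → map (nth1 U₁.letters) w ≡ t₁) pack-take U₁.map-nth1-letters))
           (sym (subst (λ w → map (nth1 U₂.letters) w ≡ t₂) pack-drop U₂.map-nth1-letters)))

  relabel-injective-on : ∀ {σ σ'} → σ ∈ quasiShuffles k l → σ' ∈ quasiShuffles k l → relabel σ ≡ relabel σ' → σ ≡ σ'
  relabel-injective-on {s₁ , s₂} {s₁' , s₂'} σ∈ σ'∈ eq =
    cong₂ _,_ (relabel-injective onto-u (length₁ qs) (length₁ qs') left≡)
              (relabel-injective onto-v (length₂ qs) (length₂ qs') (++-cancelˡ (map (nth1 s₁) u) _ _ (trans eq (cong (_++ _) (sym left≡)))))
    where
    open IsQuasiShuffle
    qs = All.lookup (quasiShuffles-sound k l) σ∈
    qs' = All.lookup (quasiShuffles-sound k l) σ'∈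
    left≡ : map (nth1 s₁) u ≡ map (nth1 s₁') u
    left≡ = begin
      map (nth1 s₁) u                                            ≡⟨ sym (take-length-++ (map (nth1 s₁) u) _) ⟩
      take (length (map (nth1 s₁) u)) (relabel (s₁ , s₂))        ≡⟨ cong₂ take (trans (length-map _ u) (sym (length-map _ u))) eq ⟩
      take (length (map (nth1 s₁') u)) (relabel (s₁' , s₂'))     ≡⟨ take-length-++ (map (nth1 s₁') u) _ ⟩
      map (nth1 s₁') u                                           ∎
      where open ≡-Reasoning

  MProd↭relabel : MProd u v ↭ map relabel (quasiShuffles k l)
  MProd↭relabel = ∼bag⇒↭ (unique∧set⇒bag uniqueMProd uniqueRelabel (mk⇔ to from))
    where
    uniqueMProd : Unique (MProd u v)
    uniqueMProd = Unique.filter⁺ inMProd? (wordsOf-unique N N)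
    uniqueRelabel : Unique (map relabel (quasiShuffles k l))
    uniqueRelabel = Unique-map-injectiveOn relabel (quasiShuffles-unique k l) relabel-injective-on
    to : ∀ {t} → t ∈ MProd u v → t ∈ map relabel (quasiShuffles k l)
    to t∈ with MProd⇒relabel t∈
    ... | σ , σ∈ , refl = ∈-map⁺ relabel σ∈
    from : ∀ {t} → t ∈ map relabel (quasiShuffles k l) → t ∈ MProd u v
    from t∈ with ∈-map⁻ relabel t∈
    ... | σ , σ∈ , refl = relabel∈MProd (All.lookup (quasiShuffles-sound k l) σ∈)

-- The action on QS(A)

module Action {c ℓ m ℓm} (K : Field c ℓ) (A : CommAlgebra K m ℓm) where
  open QS K A
  open Field K using () renaming (Carrier to 𝕂; _*_ to _*K_; 1# to 1K; _≈_ to _≈K_)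
  open CommAlgebra A using (Carrierᴹ; _≈ᴹ_; _·_; ≈ᴹ-refl; ≈ᴹ-sym; ≈ᴹ-trans; ≈ᴹ-reflexive; ·-cong; ·-assoc)

  ≡⇒∼ : ∀ {x y} → x ≡ y → x ∼ y
  ≡⇒∼ refl = ∼-refl

  QS-setoid : Setoid (c ⊔ˡ m) (c ⊔ˡ ℓ ⊔ˡ m ⊔ˡ ℓm)
  QS-setoid = record { Carrier = FS ; _≈_ = _∼_ ; isEquivalence = record { refl = ∼-refl ; sym = ∼-sym ; trans = ∼-trans } }

  ↭⇒∼ : ∀ {x y} → x ↭.↭ y → x ∼ y
  ↭⇒∼ ↭.refl = ∼-refl
  ↭⇒∼ (↭.prep x p) = ∼-++ {x ∷ []} ∼-refl (↭⇒∼ p)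
  ↭⇒∼ (↭.swap x y p) = ∼-++ (∼-comm (x ∷ []) (y ∷ [])) (↭⇒∼ p)
  ↭⇒∼ (↭.trans p q) = ∼-trans (↭⇒∼ p) (↭⇒∼ q)

  scale-cong : ∀ k {x y} → x ∼ y → scale k x ∼ scale k y
  scale-cong k ∼-refl = ∼-refl
  scale-cong k (∼-sym p) = ∼-sym (scale-cong k p)
  scale-cong k (∼-trans p q) = ∼-trans (scale-cong k p) (scale-cong k q)
  scale-cong k (∼-++ {x} {x'} {y} {y'} p q) =
    ∼-trans (≡⇒∼ (map-++ _ x y)) (∼-trans (∼-++ (scale-cong k p) (scale-cong k q)) (≡⇒∼ (sym (map-++ _ x' y'))))
  scale-cong k (∼-comm x y) = ∼-trans (≡⇒∼ (map-++ _ x y)) (∼-trans (∼-comm (scale k x) (scale k y)) (≡⇒∼ (sym (map-++ _ y x))))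
  scale-cong k (coef-+ c d w) = ∼-trans (coef-+ (k *K c) (k *K d) w) (coef-≈ w (Field.sym K (Field.distribˡ K k c d)))
  scale-cong k (coef-0 w) = ∼-trans (coef-≈ w (Field.zeroʳ K k)) (coef-0 w)
  scale-cong k (coef-≈ w c≈d) = coef-≈ w (Field.*-cong K (Field.refl K) c≈d)
  scale-cong k (word-≈ c w≈w') = word-≈ (k *K c) w≈w'
  scale-cong k (lin-+ c p a b s) = lin-+ (k *K c) p a b s
  scale-cong k (lin-* c p d a s) = ∼-trans (lin-* (k *K c) p d a s) (coef-≈ _ (Field.*-assoc K k c d))

  scale-1 : ∀ {k} → k ≈K 1K → ∀ x → scale k x ∼ x
  scale-1 k≈1 [] = ∼-refl
  scale-1 {k} k≈1 ((d , w) ∷ x) =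
    ∼-++ {(k *K d , w) ∷ []} (coef-≈ w (Field.trans K (Field.*-cong K k≈1 (Field.refl K)) (Field.*-identityˡ K d))) (scale-1 k≈1 x)

  lin-cong : ∀ {f g : Word → FS} → (∀ w → f w ∼ g w) → ∀ x → lin f x ∼ lin g x
  lin-cong f∼g [] = ∼-refl
  lin-cong f∼g ((k , w) ∷ x) = ∼-++ (scale-cong k (f∼g w)) (lin-cong f∼g x)

  lin-[] : ∀ x → lin (λ _ → []) x ≡ []
  lin-[] [] = refl
  lin-[] (_ ∷ x) = lin-[] x

  map-cong-∼ : ∀ {X : Set} (f g : X → 𝕂 × Word) (L : List X) → (∀ {x} → x ∈ L → (f x ∷ []) ∼ (g x ∷ [])) → map f L ∼ map g L
  map-cong-∼ f g [] _ = ∼-refl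
  map-cong-∼ f g (x ∷ L) f∼g = ∼-++ (f∼g (here refl)) (map-cong-∼ f g L (f∼g ∘ there))

  Labelled : Set m
  Labelled = List (ℕ × Carrierᴹ)

  labelled : ℕ → Labelled → Word
  labelled i z = map proj₂ (filter (λ p → proj₁ p ≟ i) z)

  collapse : ℕ → Labelled → Word
  collapse r z = map (λ i → prodA (labelled i z)) (range1 r)

  act : List ℕ → Word → Word
  act u w = collapse (maxL u) (zip u w)

  actM-≡ : ∀ u w → length w ≡ length u → actM u w ≡ (1K , act u w) ∷ []
  actM-≡ u w eq with length w ≟ length u
  ... | yes _ = refl
  ... | no neq = ⊥-elim (neq eq)

  actM-≢ : ∀ u w → length w ≢ length u → actM u w ≡ []
  actM-≢ u w neq with length w ≟ length u
  ... | yes eq = ⊥-elim (neq eq)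
  ... | no _ = refl

  length-act : ∀ u w → length (act u w) ≡ maxL u
  length-act u w = trans (length-map _ (range1 (maxL u))) (length-range1 (maxL u))

  shiftLabels : Labelled → Labelled
  shiftLabels = map (λ p → suc (proj₁ p) , proj₂ p)

  labelled-++ : ∀ i y z → labelled i (y ++ z) ≡ labelled i y ++ labelled i z
  labelled-++ i y z = trans (cong (map proj₂) (filter-++ (λ p → proj₁ p ≟ i) y z))
                            (map-++ proj₂ (filter (λ p → proj₁ p ≟ i) y) (filter (λ p → proj₁ p ≟ i) z))

  labelled-∷-≡ : ∀ i j a z → j ≡ i → labelled i ((j , a) ∷ z) ≡ a ∷ labelled i z
  labelled-∷-≡ i j a z j≡i = cong (map proj₂) (filter-accept (λ p → proj₁ p ≟ i) j≡i)

  labelled-∷-≢ : ∀ i j a z → j ≢ i → labelled i ((j , a) ∷ z) ≡ labelled i z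
  labelled-∷-≢ i j a z j≢i = cong (map proj₂) (filter-reject (λ p → proj₁ p ≟ i) j≢i)

  labelled-none : ∀ i z → (∀ {p} → p ∈ z → proj₁ p ≢ i) → labelled i z ≡ []
  labelled-none i z none = cong (map proj₂) (filter-none (λ p → proj₁ p ≟ i) (All.tabulate none))

  labelled-shiftLabels : ∀ j z → labelled (suc j) (shiftLabels z) ≡ labelled j z
  labelled-shiftLabels j [] = refl
  labelled-shiftLabels j ((i , a) ∷ z) with i ≟ j
  ... | yes refl = trans (labelled-∷-≡ (suc i) (suc i) a (shiftLabels z) refl)
                         (trans (cong (a ∷_) (labelled-shiftLabels j z)) (sym (labelled-∷-≡ i i a z refl)))
  ... | no i≢j = trans (labelled-∷-≢ (suc j) (suc i) a (shiftLabels z) (i≢j ∘ suc-injective))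
                       (trans (labelled-shiftLabels j z) (sym (labelled-∷-≢ j i a z i≢j)))

  zip-map-suc : ∀ (s : List ℕ) (x : Word) → zip (map suc s) x ≡ shiftLabels (zip s x)
  zip-map-suc [] x = refl
  zip-map-suc (i ∷ s) [] = refl
  zip-map-suc (i ∷ s) (a ∷ x) = cong ((suc i , a) ∷_) (zip-map-suc s x)

  collapse-suc : ∀ r z z' {h} → prodA (labelled 1 z) ≡ h → (∀ j → 1 ≤ j → labelled (suc j) z ≡ labelled j z')
               → collapse (suc r) z ≡ h ∷ collapse r z'
  collapse-suc r z z' first rest = trans (map-range1-suc (λ i → prodA (labelled i z)) r)
    (cong₂ _∷_ first (map-cong-local (All.tabulate λ j∈ → cong prodA (rest _ (proj₁ (∈-range1⁻ j∈))))))

  PositiveLabels : Labelled → Set m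
  PositiveLabels z = ∀ {p} → p ∈ z → 1 ≤ proj₁ p

  PositiveLabels-zip : ∀ {s} (x : Word) → Increasing s → PositiveLabels (zip s x)
  PositiveLabels-zip x inc p∈ = IncreasingAbove⇒< inc (zip-∈₁ p∈)

  PositiveLabels-++ : ∀ {y z} → PositiveLabels y → PositiveLabels z → PositiveLabels (y ++ z)
  PositiveLabels-++ {y} pos-y pos-z p∈ with ∈-++⁻ y p∈
  ... | inj₁ q = pos-y q
  ... | inj₂ q = pos-z q

  labelled-0 : ∀ {z} → PositiveLabels z → labelled 0 z ≡ []
  labelled-0 pos = labelled-none 0 _ λ p∈ eq → 1+n≰n (≤-trans (pos p∈) (≤-reflexive eq))

  labelled-1-shift : ∀ a z → PositiveLabels z → labelled 1 ((1 , a) ∷ shiftLabels z) ≡ a ∷ []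
  labelled-1-shift a z pos = trans (labelled-∷-≡ 1 1 a (shiftLabels z) refl) (cong (a ∷_) (trans (labelled-shiftLabels 0 z) (labelled-0 pos)))

  labelled-suc-shift : ∀ a z j → 1 ≤ j → labelled (suc j) ((1 , a) ∷ shiftLabels z) ≡ labelled j z
  labelled-suc-shift a z (suc j) _ = trans (labelled-∷-≢ (suc (suc j)) 1 a (shiftLabels z) (λ ())) (labelled-shiftLabels (suc j) z)

  labelled-1-shift-++ : ∀ c y z → PositiveLabels y → PositiveLabels z → labelled 1 (shiftLabels y ++ (1 , c) ∷ shiftLabels z) ≡ c ∷ []
  labelled-1-shift-++ c y z pos-y pos-z = trans (labelled-++ 1 (shiftLabels y) ((1 , c) ∷ shiftLabels z))
    (cong₂ _++_ (trans (labelled-shiftLabels 0 y) (labelled-0 pos-y)) (labelled-1-shift c z pos-z))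

  labelled-suc-shift-++ : ∀ c y z j → 1 ≤ j → labelled (suc j) (shiftLabels y ++ (1 , c) ∷ shiftLabels z) ≡ labelled j (y ++ z)
  labelled-suc-shift-++ c y z j 1≤j = trans (labelled-++ (suc j) (shiftLabels y) ((1 , c) ∷ shiftLabels z))
    (trans (cong₂ _++_ (labelled-shiftLabels j y) (labelled-suc-shift c z j 1≤j)) (sym (labelled-++ j y z)))

  collapse-range1 : ∀ (x : Word) → collapse (length x) (zip (range1 (length x)) x) ≡ x
  collapse-range1 [] = refl
  collapse-range1 (a ∷ x) = begin
    collapse (suc (length x)) (zip (range1 (suc (length x))) (a ∷ x))    ≡⟨ cong (λ r → collapse (suc (length x)) (zip r (a ∷ x))) (range1-suc (length x)) ⟩
    collapse (suc (length x)) ((1 , a) ∷ zip (map suc (range1 (length x))) x)  ≡⟨ cong (λ z → collapse (suc (length x)) ((1 , a) ∷ z)) (zip-map-suc _ x) ⟩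
    collapse (suc (length x)) ((1 , a) ∷ shiftLabels z)
      ≡⟨ collapse-suc (length x) ((1 , a) ∷ shiftLabels z) z
           (cong prodA (labelled-1-shift a z (PositiveLabels-zip x (Increasing-range1 _)))) (labelled-suc-shift a z) ⟩
    a ∷ collapse (length x) z                                          ≡⟨ cong (a ∷_) (collapse-range1 x) ⟩
    a ∷ x                                                              ∎
    where
    open ≡-Reasoning
    z = zip (range1 (length x)) x

  qshTerm : Word → Word → IndexPair → Word
  qshTerm b c σ = collapse (maxL (merged σ)) (zip (proj₁ σ) b ++ zip (proj₂ σ) c)

  module _ {k l σ} (qs : IsQuasiShuffle k l σ) where
    private
      s₁ = proj₁ σ
      s₂ = proj₂ σ
      inc₁ = IsQuasiShuffle.increasing₁ qs
      inc₂ = IsQuasiShuffle.increasing₂ qs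

    qshTerm-consLeft : ∀ a x c → qshTerm (a ∷ x) c (consLeft σ) ≡ a ∷ qshTerm x c σ
    qshTerm-consLeft a x c = begin
      collapse (maxL (merged (consLeft σ))) ((1 , a) ∷ zip (map suc s₁) x ++ zip (map suc s₂) c)
        ≡⟨ cong₂ (λ r y → collapse r ((1 , a) ∷ y)) (maxL-merged-cons consLeft-shiftsMerged σ) shifted ⟩
      collapse (suc (maxL (merged σ))) ((1 , a) ∷ shiftLabels z)
        ≡⟨ collapse-suc (maxL (merged σ)) ((1 , a) ∷ shiftLabels z) z (cong prodA (labelled-1-shift a z positive)) (labelled-suc-shift a z) ⟩
      a ∷ qshTerm x c σ ∎
      where
      open ≡-Reasoning
      z = zip s₁ x ++ zip s₂ c
      positive = PositiveLabels-++ (PositiveLabels-zip x inc₁) (PositiveLabels-zip c inc₂)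
      shifted : zip (map suc s₁) x ++ zip (map suc s₂) c ≡ shiftLabels z
      shifted = trans (cong₂ _++_ (zip-map-suc s₁ x) (zip-map-suc s₂ c)) (sym (map-++ _ (zip s₁ x) (zip s₂ c)))

    qshTerm-consRight : ∀ b c₀ c → qshTerm b (c₀ ∷ c) (consRight σ) ≡ c₀ ∷ qshTerm b c σ
    qshTerm-consRight b c₀ c = begin
      collapse (maxL (merged (consRight σ))) (zip (map suc s₁) b ++ (1 , c₀) ∷ zip (map suc s₂) c)
        ≡⟨ cong₂ collapse (maxL-merged-cons consRight-shiftsMerged σ) (cong₂ (λ y y' → y ++ (1 , c₀) ∷ y') (zip-map-suc s₁ b) (zip-map-suc s₂ c)) ⟩
      collapse (suc (maxL (merged σ))) (shiftLabels y ++ (1 , c₀) ∷ shiftLabels z)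
        ≡⟨ collapse-suc (maxL (merged σ)) (shiftLabels y ++ (1 , c₀) ∷ shiftLabels z) (y ++ z)
             (cong prodA (labelled-1-shift-++ c₀ y z (PositiveLabels-zip b inc₁) (PositiveLabels-zip c inc₂)))
                                      (labelled-suc-shift-++ c₀ y z) ⟩
      c₀ ∷ qshTerm b c σ ∎
      where
      open ≡-Reasoning
      y = zip s₁ b
      z = zip s₂ c

    qshTerm-consBoth : ∀ a x c₀ c → qshTerm (a ∷ x) (c₀ ∷ c) (consBoth σ) ≡ (a · c₀) ∷ qshTerm x c σ
    qshTerm-consBoth a x c₀ c = begin
      collapse (maxL (merged (consBoth σ))) ((1 , a) ∷ zip (map suc s₁) x ++ (1 , c₀) ∷ zip (map suc s₂) c)
        ≡⟨ cong₂ (λ r w → collapse r ((1 , a) ∷ w)) (maxL-merged-cons consBoth-shiftsMerged σ)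
                 (cong₂ (λ y y' → y ++ (1 , c₀) ∷ y') (zip-map-suc s₁ x) (zip-map-suc s₂ c)) ⟩
      collapse (suc (maxL (merged σ))) ((1 , a) ∷ shiftLabels y ++ (1 , c₀) ∷ shiftLabels z)
        ≡⟨ collapse-suc (maxL (merged σ)) ((1 , a) ∷ rest) (y ++ z) (cong prodA first) later ⟩
      (a · c₀) ∷ qshTerm x c σ ∎
      where
      open ≡-Reasoning
      y = zip s₁ x
      z = zip s₂ c
      rest = shiftLabels y ++ (1 , c₀) ∷ shiftLabels z
      first : labelled 1 ((1 , a) ∷ rest) ≡ a ∷ c₀ ∷ []
      first = trans (labelled-∷-≡ 1 1 a rest refl) (cong (a ∷_) (labelled-1-shift-++ c₀ y z (PositiveLabels-zip x inc₁) (PositiveLabels-zip c inc₂)))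
      later : ∀ j → 1 ≤ j → labelled (suc j) ((1 , a) ∷ rest) ≡ labelled j (y ++ z)
      later (suc j) 1≤j = trans (labelled-∷-≢ (suc (suc j)) 1 a rest (λ ())) (labelled-suc-shift-++ c₀ y z (suc j) 1≤j)

  qsh-expansion : ∀ b c → qsh b c ≡ map (λ σ → 1K , qshTerm b c σ) (quasiShuffles (length b) (length c))
  qsh-expansion [] c = cong (λ w → (1K , w) ∷ [])
    (sym (trans (cong (λ r → collapse r (zip (range1 (length c)) c)) (maxL-range1 (length c))) (collapse-range1 c)))
  qsh-expansion (a ∷ x) [] = cong (λ w → (1K , w) ∷ []) (sym (begin
    collapse (maxL (R ++ [])) (zip R (a ∷ x) ++ [])  ≡⟨ cong₂ (λ r z → collapse (maxL r) z) (++-identityʳ R) (++-identityʳ (zip R (a ∷ x))) ⟩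
    collapse (maxL R) (zip R (a ∷ x))              ≡⟨ cong (λ r → collapse r (zip R (a ∷ x))) (maxL-range1 (length (a ∷ x))) ⟩
    collapse (length (a ∷ x)) (zip R (a ∷ x))      ≡⟨ collapse-range1 (a ∷ x) ⟩
    a ∷ x                                          ∎))
    where
    open ≡-Reasoning
    R = range1 (length (a ∷ x))
  qsh-expansion (a ∷ x) (b ∷ y) = begin
    prepend a (qsh x (b ∷ y)) ++ prepend b (qsh (a ∷ x) y) ++ prepend (a · b) (qsh x y)
      ≡⟨ cong₂ _++_ (prepend-expansion (length x) (suc (length y)) consLeft (qsh-expansion x (b ∷ y)) (λ qs → qshTerm-consLeft qs a x (b ∷ y)))
                    (cong₂ _++_ (prepend-expansion (suc (length x)) (length y) consRight (qsh-expansion (a ∷ x) y) (λ qs → qshTerm-consRight qs (a ∷ x) b y))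
                                (prepend-expansion (length x) (length y) consBoth (qsh-expansion x y) (λ qs → qshTerm-consBoth qs a x b y))) ⟩
    map term (map consLeft Q₁) ++ map term (map consRight Q₂) ++ map term (map consBoth Q₃)
      ≡⟨ sym (trans (map-++ term (map consLeft Q₁) _) (cong (map term (map consLeft Q₁) ++_) (map-++ term (map consRight Q₂) _))) ⟩
    map term (quasiShuffles (length (a ∷ x)) (length (b ∷ y))) ∎
    where
    open ≡-Reasoning
    term = λ σ → 1K , qshTerm (a ∷ x) (b ∷ y) σ
    Q₁ = quasiShuffles (length x) (suc (length y))
    Q₂ = quasiShuffles (suc (length x)) (length y)
    Q₃ = quasiShuffles (length x) (length y)
    prepend-expansion : ∀ k l (cons : IndexPair → IndexPair) {d b' c'} → qsh b' c' ≡ map (λ σ → 1K , qshTerm b' c' σ) (quasiShuffles k l)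
                      → (∀ {σ} → IsQuasiShuffle k l σ → qshTerm (a ∷ x) (b ∷ y) (cons σ) ≡ d ∷ qshTerm b' c' σ)
                      → prepend d (qsh b' c') ≡ map term (map cons (quasiShuffles k l))
    prepend-expansion k l cons {d} {b'} {c'} expansion cons-term = begin
      prepend d (qsh b' c')                                             ≡⟨ cong (prepend d) expansion ⟩
      prepend d (map (λ σ → 1K , qshTerm b' c' σ) (quasiShuffles k l))  ≡⟨ sym (map-∘ (quasiShuffles k l)) ⟩
      map (λ σ → 1K , d ∷ qshTerm b' c' σ) (quasiShuffles k l)          ≡⟨ map-cong-local (All.map (λ qs → cong (1K ,_) (sym (cons-term qs))) (quasiShuffles-sound k l)) ⟩
      map (term ∘ cons) (quasiShuffles k l)                             ≡⟨ map-∘ (quasiShuffles k l) ⟩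
      map term (map cons (quasiShuffles k l))                           ∎

  squash : Word → Word
  squash [] = []
  squash (a ∷ x) = prodA (a ∷ x) ∷ []

  prodA-∷-++-∷ : ∀ a x b y → prodA ((a ∷ x) ++ (b ∷ y)) ≈ᴹ (prodA (a ∷ x) · prodA (b ∷ y))
  prodA-∷-++-∷ a [] b y = ≈ᴹ-refl
  prodA-∷-++-∷ a (a' ∷ x) b y = ≈ᴹ-trans (·-cong ≈ᴹ-refl (prodA-∷-++-∷ a' x b y)) (≈ᴹ-sym (·-assoc a (prodA (a' ∷ x)) (prodA (b ∷ y))))

  prodA-++-squash : ∀ x y → prodA (x ++ y) ≈ᴹ prodA (squash x ++ squash y)
  prodA-++-squash [] [] = ≈ᴹ-refl
  prodA-++-squash [] (b ∷ y) = ≈ᴹ-refl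
  prodA-++-squash (a ∷ x) [] = ≈ᴹ-reflexive (cong prodA (++-identityʳ (a ∷ x)))
  prodA-++-squash (a ∷ x) (b ∷ y) = prodA-∷-++-∷ a x b y

  filter-≡[_] : ∀ {pl} {P : Pred ℕ pl} (P? : Decidable P) {R i} → Unique R → i ∈ R → P i → (∀ {i'} → i' ∈ R → P i' → i' ≡ i)
              → filter P? R ≡ i ∷ []
  filter-≡[_] P? (i∉R ∷ _) (here refl) Pi only-i =
    trans (filter-accept P? Pi) (cong (_ ∷_) (filter-none P? (All.tabulate λ z∈ Pz → All.lookup i∉R z∈ (sym (only-i (there z∈) Pz)))))
  filter-≡[_] P? (i'∉R ∷ uniqueR) (there i∈) Pi only-i =
    trans (filter-reject P? (λ Pi' → All.lookup i'∉R i∈ (only-i (here refl) Pi'))) (filter-≡[ P? ] uniqueR i∈ Pi (only-i ∘ there))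

  filter-cong-on : ∀ {a pl ql} {X : Set a} {P : Pred X pl} {Q : Pred X ql} (P? : Decidable P) (Q? : Decidable Q) xs
                 → (∀ {x} → x ∈ xs → P x → Q x) → (∀ {x} → x ∈ xs → Q x → P x) → filter P? xs ≡ filter Q? xs
  filter-cong-on P? Q? [] _ _ = refl
  filter-cong-on P? Q? (x ∷ xs) P⇒Q Q⇒P with P? x
  ... | yes px = trans (cong (x ∷_) (filter-cong-on P? Q? xs (P⇒Q ∘ there) (Q⇒P ∘ there))) (sym (filter-accept Q? (P⇒Q (here refl) px)))
  ... | no ¬px = trans (filter-cong-on P? Q? xs (P⇒Q ∘ there) (Q⇒P ∘ there)) (sym (filter-reject Q? (¬px ∘ Q⇒P (here refl))))

  labelled-map : ∀ {a} {X : Set a} (h : X → ℕ) (F : X → Carrierᴹ) j R → labelled j (map (λ x → h x , F x) R) ≡ map F (filter (λ x → h x ≟ j) R)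
  labelled-map h F j [] = refl
  labelled-map h F j (x ∷ R) with h x ≟ j
  ... | yes hx≡j = trans (labelled-∷-≡ j (h x) (F x) _ hx≡j)
                         (trans (cong (F x ∷_) (labelled-map h F j R)) (sym (cong (map F) (filter-accept (λ x → h x ≟ j) hx≡j))))
  ... | no hx≢j = trans (labelled-∷-≢ j (h x) (F x) _ hx≢j)
                        (trans (labelled-map h F j R) (sym (cong (map F) (filter-reject (λ x → h x ≟ j) hx≢j))))

  zip-map₁ : ∀ (h : ℕ → ℕ) (u : List ℕ) (p : Word) → zip (map h u) p ≡ map (λ q → h (proj₁ q) , proj₂ q) (zip u p)
  zip-map₁ h [] p = refl
  zip-map₁ h (i ∷ u) [] = refl
  zip-map₁ h (i ∷ u) (a ∷ p) = cong ((h i , a) ∷_) (zip-map₁ h u p)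

  zip-++ : ∀ (y : List ℕ) (p : Word) z q → length y ≡ length p → zip (y ++ z) (p ++ q) ≡ zip y p ++ zip z q
  zip-++ [] [] z q _ = refl
  zip-++ (i ∷ y) (a ∷ p) z q len = cong ((i , a) ∷_) (zip-++ y p z q (suc-injective len))

  ∈-zip-fill : ∀ {u : List ℕ} {p : Word} {i} → length u ≡ length p → i ∈ u → Σ Carrierᴹ λ a → (i , a) ∈ zip u p
  ∈-zip-fill {_ ∷ _} {a ∷ _} _ (here refl) = a , here refl
  ∈-zip-fill {_ ∷ _} {_ ∷ _} len (there i∈) with ∈-zip-fill (suc-injective len) i∈
  ... | a , q = a , there q

  -- Spreading the letters of p M_u over the positions s agrees, label by label, with acting by the
  -- relabelled word s ∘ u and multiplying the letters that share a label.
  module _ {u} (packed : IsPacked u) {s} (length-s : length s ≡ maxL u) (increasing : Increasing s)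
           (p : Word) (length-p : length u ≡ length p) where
    private
      k = maxL u
      onto-u = IsPacked⇒Onto packed
      open Onto onto-u
      open Relabel onto-u length-s increasing
      g = nth1 s
      F = λ i → prodA (labelled i (zip u p))
      g-injective : ∀ {i i'} → 1 ≤ i → i ≤ k → 1 ≤ i' → i' ≤ k → g i ≡ g i' → i ≡ i'
      g-injective = IncreasingOn-injective (λ 1≤z z<y y≤k → nth1-mono increasing 1≤z z<y (≤-trans y≤k (≤-reflexive (sym length-s))))

      labelled-zip-act-map : ∀ j → labelled j (zip s (act u p)) ≡ map F (filter (λ i → g i ≟ j) (range1 k))
      labelled-zip-act-map j = trans (cong (labelled j) (zip-map-range1 s F k length-s)) (labelled-map g F j (range1 k))

      labelled-zip-relabel : ∀ j → labelled j (zip (map g u) p) ≡ map proj₂ (filter (λ q → g (proj₁ q) ≟ j) (zip u p))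
      labelled-zip-relabel j = trans (cong (labelled j) (zip-map₁ g u p)) (labelled-map (g ∘ proj₁) proj₂ j (zip u p))

      squash-∈ : ∀ {a x} → a ∈ x → squash x ≡ prodA x ∷ []
      squash-∈ {x = _ ∷ _} _ = refl

      labelled-zip-act-image : ∀ {i} → 1 ≤ i → i ≤ k → labelled (g i) (zip s (act u p)) ≡ squash (labelled (g i) (zip (map g u) p))
      labelled-zip-act-image {i} 1≤i i≤k = trans lhs (sym rhs)
        where
        lhs : labelled (g i) (zip s (act u p)) ≡ F i ∷ []
        lhs = trans (labelled-zip-act-map (g i)) (cong (map F) (filter-≡[ (λ i' → g i' ≟ g i) ] (unique-range1 k) (∈-range1⁺ 1≤i i≤k) refl
                λ i'∈ gi'≡gi → let (1≤i' , i'≤k) = ∈-range1⁻ i'∈ in g-injective 1≤i' i'≤k 1≤i i≤k gi'≡gi))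
        same-filter : filter (λ q → g (proj₁ q) ≟ g i) (zip u p) ≡ filter (λ q → proj₁ q ≟ i) (zip u p)
        same-filter = filter-cong-on _ _ (zip u p)
          (λ q∈ gq≡gi → let (1≤q , q≤k) = bounded (zip-∈₁ q∈) in g-injective 1≤q q≤k 1≤i i≤k gq≡gi)
          (λ _ q≡i → cong g q≡i)
        rhs : squash (labelled (g i) (zip (map g u) p)) ≡ F i ∷ []
        rhs = let (a , ia∈) = ∈-zip-fill length-p (onto 1≤i i≤k) in
          trans (cong squash (trans (labelled-zip-relabel (g i)) (cong (map proj₂) same-filter)))
                (squash-∈ (∈-map⁺ proj₂ (∈-filter⁺ (λ q → proj₁ q ≟ i) ia∈ refl)))

      labelled-zip-act-∉ : ∀ {j} → j ∉ s → labelled j (zip s (act u p)) ≡ squash (labelled j (zip (map g u) p))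
      labelled-zip-act-∉ {j} j∉s =
        trans (trans (labelled-zip-act-map j) (cong (map F) (filter-none _ (All.tabulate λ i∈ gi≡j → j∉s (subst (_∈ s) gi≡j (g∈s i∈))))))
              (sym (cong squash (labelled-none j _ λ q∈ gq≡j → j∉s (subst (_∈ s) gq≡j (relabel⊆ (zip-∈₁ q∈))))))
        where
        g∈s : ∀ {i} → i ∈ range1 k → g i ∈ s
        g∈s i∈ = let (1≤i , i≤k) = ∈-range1⁻ i∈ in nth1-∈ 1≤i (≤-trans i≤k (≤-reflexive (sym length-s)))

    labelled-zip-act : ∀ j → labelled j (zip s (act u p)) ≡ squash (labelled j (zip (map g u) p))
    labelled-zip-act j with j ∈? s
    ... | no j∉s = labelled-zip-act-∉ j∉s
    ... | yes j∈s with ∈⇒nth1 j∈s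
    ...   | i , (1≤i , i≤) , refl = labelled-zip-act-image 1≤i (≤-trans i≤ (≤-reflexive length-s))

  module _ {u v} (packed-u : IsPacked u) (packed-v : IsPacked v) where
    open Relabelling packed-u packed-v

    act-relabel : ∀ {σ} → IsQuasiShuffle k l σ → ∀ p s → length u ≡ length p → length v ≡ length s
                → Pointwise _≈ᴹ_ (act (relabel σ) (p ++ s)) (qshTerm (act u p) (act v s) σ)
    act-relabel {σ@(s₁ , s₂)} qs p s length-p length-s =
      subst (λ w → Pointwise _≈ᴹ_ w (qshTerm (act u p) (act v s) σ)) (sym act≡)
        (Pointwise.map⁺ _ _ (Pointwise.refl same-product))
      where
      open IsQuasiShuffle qs
      y = zip (map (nth1 s₁) u) p
      z = zip (map (nth1 s₂) v) s
      act≡ : act (relabel σ) (p ++ s) ≡ collapse (maxL (merged σ)) (y ++ z)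
      act≡ = cong₂ collapse (maxL-cong (relabel⊆merged qs) (merged⊆relabel qs))
                            (zip-++ (map (nth1 s₁) u) p (map (nth1 s₂) v) s (trans (length-map _ u) length-p))
      same-product : ∀ {j} → prodA (labelled j (y ++ z)) ≈ᴹ prodA (labelled j (zip s₁ (act u p) ++ zip s₂ (act v s)))
      same-product {j} = begin
        prodA (labelled j (y ++ z))                                           ≡⟨ cong prodA (labelled-++ j y z) ⟩
        prodA (labelled j y ++ labelled j z)                                  ≈⟨ prodA-++-squash (labelled j y) (labelled j z) ⟩
        prodA (squash (labelled j y) ++ squash (labelled j z))                ≡⟨ cong prodA (cong₂ _++_ (sym (labelled-zip-act packed-u length₁ increasing₁ p length-p j))
                                                                                                        (sym (labelled-zip-act packed-v length₂ increasing₂ s length-s j))) ⟩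
        prodA (labelled j (zip s₁ (act u p)) ++ labelled j (zip s₂ (act v s))) ≡⟨ cong prodA (sym (labelled-++ j (zip s₁ (act u p)) (zip s₂ (act v s)))) ⟩
        prodA (labelled j (zip s₁ (act u p) ++ zip s₂ (act v s)))             ∎
        where open ≈-Reasoning (CommAlgebra.≈ᴹ-setoid A)

  concatMap-[] : ∀ {a} {X : Set a} (f : X → FS) L → (∀ {x} → x ∈ L → f x ≡ []) → concatMap f L ≡ []
  concatMap-[] f [] _ = refl
  concatMap-[] f (x ∷ L) vanish rewrite vanish (here refl) = concatMap-[] f L (vanish ∘ there)

  concatMap-singleton : ∀ {X : Set} (f : X → FS) (g : X → 𝕂 × Word) L → (∀ {x} → x ∈ L → f x ≡ g x ∷ []) → concatMap f L ≡ map g L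
  concatMap-singleton f g [] _ = refl
  concatMap-singleton f g (x ∷ L) single rewrite single (here refl) = cong (g x ∷_) (concatMap-singleton f g L (single ∘ there))

  concatMap-splits-∷ : ∀ (F : Word × Word → FS) a w
                     → concatMap F (map (λ { (p , s) → a ∷ p , s }) (splits w)) ≡ concatMap (λ ps → F (a ∷ proj₁ ps , proj₂ ps)) (splits w)
  concatMap-splits-∷ F a w = cong List.concat (sym (map-∘ (splits w)))

  splits-[] : ∀ (F : Word × Word → FS) w → (∀ p s → p ++ s ≡ w → F (p , s) ≡ []) → concatMap F (splits w) ≡ []
  splits-[] F [] vanish rewrite vanish [] [] refl = refl
  splits-[] F (a ∷ w) vanish rewrite vanish [] (a ∷ w) refl =
    trans (concatMap-splits-∷ F a w) (splits-[] (λ ps → F (a ∷ proj₁ ps , proj₂ ps)) w (λ p s eq → vanish (a ∷ p) s (cong (a ∷_) eq)))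

  splits-at : ∀ (F : Word × Word → FS) n w → (∀ p s → length p ≢ n → F (p , s) ≡ []) → n ≤ length w
            → concatMap F (splits w) ≡ F (take n w , drop n w)
  splits-at F zero [] _ _ = ++-identityʳ (F ([] , []))
  splits-at F zero (a ∷ w) vanish _ =
    trans (cong (F ([] , a ∷ w) ++_) (trans (concatMap-splits-∷ F a w)
      (concatMap-[] _ (splits w) (λ {ps} _ → vanish (a ∷ proj₁ ps) (proj₂ ps) (λ ())))))
      (++-identityʳ (F ([] , a ∷ w)))
  splits-at F (suc n) (a ∷ w) vanish (s≤s n≤) rewrite vanish [] (a ∷ w) (λ ()) =
    trans (concatMap-splits-∷ F a w)
      (splits-at (λ ps → F (a ∷ proj₁ ps , proj₂ ps)) n w (λ p s p≢n → vanish (a ∷ p) s (p≢n ∘ suc-injective)) n≤)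

  ρ-word-≢ : ∀ u p → length p ≢ length u → ρ u (word p) ≡ []
  ρ-word-≢ u p neq = cong (λ z → scale 1K z ++ []) (actM-≢ u p neq)

  ρ-word-≡ : ∀ u p → length p ≡ length u → ρ u (word p) ≡ (1K *K 1K , act u p) ∷ []
  ρ-word-≡ u p eq = cong (λ z → scale 1K z ++ []) (actM-≡ u p eq)

  ⊎-[]ʳ : ∀ x → x ⊎ [] ≡ []
  ⊎-[]ʳ = lin-[]

  ρ⊎ρ-word : ∀ u v p s → length p ≡ length u → length s ≡ length v → (ρ u (word p) ⊎ ρ v (word s)) ∼ qsh (act u p) (act v s)
  ρ⊎ρ-word u v p s length-p length-s = begin
    ρ u (word p) ⊎ ρ v (word s)                    ≡⟨ cong₂ _⊎_ (ρ-word-≡ u p length-p) (ρ-word-≡ v s length-s) ⟩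
    scale 1·1 (scale 1·1 q ++ []) ++ []            ≡⟨ ++-identityʳ (scale 1·1 (scale 1·1 q ++ [])) ⟩
    scale 1·1 (scale 1·1 q ++ [])                  ≈⟨ scale-cong 1·1 (≡⇒∼ (++-identityʳ (scale 1·1 q))) ⟩
    scale 1·1 (scale 1·1 q)                        ≈⟨ scale-1 1·1≈1 (scale 1·1 q) ⟩
    scale 1·1 q                                    ≈⟨ scale-1 1·1≈1 q ⟩
    q                                              ∎
    where
    q = qsh (act u p) (act v s)
    1·1 = 1K *K 1K
    1·1≈1 = Field.*-identityˡ K 1K
    open ≈-Reasoning QS-setoid

  -- G is the pattern-matching lambda inside _⋆_: such lambdas are generative, so it can only be related
  -- to the intended function propositionally, through G≡.
  module _ {u v} (packed-u : IsPacked u) (packed-v : IsPacked v) (w : Word)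
           (G : Word × Word → FS) (G≡ : ∀ p s → G (p , s) ≡ ρ u (word p) ⊎ ρ v (word s)) where
    open Relabelling packed-u packed-v

    private
      length-MProd : ∀ {t} → t ∈ MProd u v → length t ≡ N
      length-MProd t∈ = wordsOf-length N N (proj₁ (∈-filter⁻ inMProd? {xs = wordsOf N N} t∈))

      G-≢ : ∀ p s → length p ≢ n → G (p , s) ≡ []
      G-≢ p s p≢n = trans (G≡ p s) (cong (_⊎ ρ v (word s)) (ρ-word-≢ u p p≢n))

    MProd-action-≢ : length w ≢ N → concatMap (λ t → actM t w) (MProd u v) ≡ concatMap G (splits w)
    MProd-action-≢ w≢N = trans (concatMap-[] _ (MProd u v) λ t∈ → actM-≢ _ w λ w≡t → w≢N (trans w≡t (length-MProd t∈)))
                               (sym (splits-[] G w vanish))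
      where
      vanish : ∀ p s → p ++ s ≡ w → G (p , s) ≡ []
      vanish p s p++s≡w with length p ≟ n
      ... | no p≢n = G-≢ p s p≢n
      ... | yes p≡n = trans (G≡ p s) (trans (cong (ρ u (word p) ⊎_) (ρ-word-≢ v s s≢n')) (⊎-[]ʳ (ρ u (word p))))
        where
        s≢n' : length s ≢ length v
        s≢n' s≡n' = w≢N (trans (sym (cong length p++s≡w)) (trans (length-++ p) (cong₂ _+_ p≡n s≡n')))

    MProd-action-≡ : length w ≡ N → concatMap (λ t → actM t w) (MProd u v) ∼ concatMap G (splits w)
    MProd-action-≡ w≡N = begin
      concatMap (λ t → actM t w) (MProd u v)              ≡⟨ concatMap-singleton _ _ (MProd u v) (λ t∈ → actM-≡ _ w (trans w≡N (sym (length-MProd t∈)))) ⟩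
      map (λ t → 1K , act t w) (MProd u v)                ≈⟨ ↭⇒∼ (↭.map⁺ _ MProd↭relabel) ⟩
      map (λ t → 1K , act t w) (map relabel (quasiShuffles k l))  ≡⟨ sym (map-∘ (quasiShuffles k l)) ⟩
      map (λ σ → 1K , act (relabel σ) w) (quasiShuffles k l)     ≈⟨ map-cong-∼ _ _ (quasiShuffles k l) relabel-term ⟩
      map (λ σ → 1K , qshTerm (act u p) (act v s) σ) (quasiShuffles k l)  ≡⟨ sym qsh-expansion′ ⟩
      qsh (act u p) (act v s)                             ≈⟨ ∼-sym (ρ⊎ρ-word u v p s length-p length-s) ⟩
      ρ u (word p) ⊎ ρ v (word s)                         ≡⟨ sym (G≡ p s) ⟩
      G (p , s)                                           ≡⟨ sym (splits-at G n w G-≢ n≤w) ⟩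
      concatMap G (splits w)                              ∎
      where
      open ≈-Reasoning QS-setoid
      p = take n w
      s = drop n w
      n≤w : n ≤ length w
      n≤w = ≤-trans (m≤m+n n (length v)) (≤-reflexive (sym w≡N))
      length-p : length p ≡ n
      length-p = trans (length-take n w) (m≤n⇒m⊓n≡m n≤w)
      length-s : length s ≡ length v
      length-s = trans (length-drop n w) (trans (cong (ℕ._∸ n) w≡N) (m+n∸m≡n n (length v)))
      relabel-term : ∀ {σ} → σ ∈ quasiShuffles k l → ((1K , act (relabel σ) w) ∷ []) ∼ ((1K , qshTerm (act u p) (act v s) σ) ∷ [])
      relabel-term {σ} σ∈ = ∼-trans (≡⇒∼ (cong (λ w' → (1K , act (relabel σ) w') ∷ []) (sym (take++drop≡id n w))))
                          (word-≈ 1K (act-relabel packed-u packed-v (All.lookup (quasiShuffles-sound k l) σ∈) p s (sym length-p) (sym length-s)))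
      qsh-expansion′ : qsh (act u p) (act v s) ≡ map (λ σ → 1K , qshTerm (act u p) (act v s) σ) (quasiShuffles k l)
      qsh-expansion′ = trans (qsh-expansion (act u p) (act v s))
                             (cong₂ (λ k' l' → map (λ σ → 1K , qshTerm (act u p) (act v s) σ) (quasiShuffles k' l')) (length-act u p) (length-act v s))

    MProd-action : concatMap (λ t → actM t w) (MProd u v) ∼ concatMap G (splits w)
    MProd-action with length w ≟ N
    ... | yes w≡N = MProd-action-≡ w≡N
    ... | no w≢N = ≡⇒∼ (MProd-action-≢ w≢N)

mainTheorem4 : ∀ {c ℓ m ℓm} (K : Field c ℓ) → CharZero K → (A : CommAlgebra K m ℓm)
    → (u v : List ℕ) → IsPacked u → IsPacked v
    → (x : QS.FS K A)
    → QS._∼_ K A (QS.ρΣ K A (MProd u v) x) (QS._⋆_ K A (QS.ρ K A u) (QS.ρ K A v) x)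
mainTheorem4 K _ A u v packed-u packed-v = lin-cong λ w → MProd-action packed-u packed-v w _ λ _ _ → refl
  where open Action K A
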